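{- Let $\alpha,n\in\mathbb{N}$ with $\alpha\geq 2$ and $n\geq 2\alpha+3+(\alpha\bmod 2)$, and let $k$ be a positive integer. Then: (1) if $\frac{2}{\alpha}k+4\leq n<\frac{2}{\alpha-1}k+3$, then $\gamma_{\times k}(K(n,2))=k+2\alpha$; (2) if $n=\left\lceil\frac{2}{\alpha}k\right\rceil+3$, then $\gamma_{\times k}(K(n,2))=k+2\alpha+1$.
   Context: The Kneser graph $K(n,2)$ has as vertices the $2$-subsets of $[n]=\{1,\dots,n\}$, two vertices adjacent iff disjoint. For a vertex $v$, $N[v]$ is its closed neighbourhood. A set $D$ of vertices is a $k$-tuple dominating set if $|N[v]\cap D|\geq k$ for every vertex $v$; $\gamma_{\times k}(K(n,2))$ is the minimum cardinality of such a set. -}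

module Defs where

open import Data.Nat using (ℕ; zero; suc; _+_; _≤_)
open import Data.Nat.DivMod using (_/_)
open import Data.Fin using (Fin; _<_)
open import Data.Fin.Properties using (_≟_)
open import Data.Product using (_×_; _,_; ∃)
open import Data.Sum using (_⊎_)
open import Data.List using (List; length; filter)
open import Data.List.Relation.Unary.All using (All)
open import Data.List.Relation.Unary.Unique.Propositional using (Unique)
open import Relation.Binary.PropositionalEquality using (_≡_; _≢_)
open import Relation.Nullary using (Dec; ¬?)
open import Relation.Nullary.Decidable using (_×-dec_; _⊎-dec_)
open import Data.Product.Properties using (≡-dec)

-- Ceiling of m / d (d > 0); the value at d = 0 is irrelevant (set to 0).
⌈_/_⌉ : ℕ → ℕ → ℕ
⌈ m / zero ⌉ = 0
⌈ m / suc d ⌉ = (m + d) / suc d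

-- A 2-subset {i,j} of [n] is represented by the ordered pair (i , j) with i < j.
Pair : ℕ → Set
Pair n = Fin n × Fin n

IsVertex : {n : ℕ} → Pair n → Set
IsVertex (i , j) = i < j

-- Two 2-subsets are disjoint (adjacent in K(n,2)).
Disjoint : {n : ℕ} → Pair n → Pair n → Set
Disjoint (a , b) (c , d) = (a ≢ c × a ≢ d) × (b ≢ c × b ≢ d)

disjoint? : {n : ℕ} → (u v : Pair n) → Dec (Disjoint u v)
disjoint? (a , b) (c , d) =
  (¬? (a ≟ c) ×-dec ¬? (a ≟ d)) ×-dec (¬? (b ≟ c) ×-dec ¬? (b ≟ d))

InClosedNbhd : {n : ℕ} → Pair n → Pair n → Set
InClosedNbhd v u = u ≡ v ⊎ Disjoint u v

inClosedNbhd? : {n : ℕ} → (v u : Pair n) → Dec (InClosedNbhd v u)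
inClosedNbhd? v u = ≡-dec _≟_ _≟_ u v ⊎-dec disjoint? u v

nbhdCount : {n : ℕ} → Pair n → List (Pair n) → ℕ
nbhdCount v D = length (filter (inClosedNbhd? v) D)

IsKTupleDominating : (n k : ℕ) → List (Pair n) → Set
IsKTupleDominating n k D =
  All IsVertex D × Unique D × (∀ (v : Pair n) → IsVertex v → k ≤ nbhdCount v D)

γ×≡ : (n k m : ℕ) → Set
γ×≡ n k m =
  ∃ (λ (D : List (Pair n)) → IsKTupleDominating n k D × length D ≡ m)
  × (∀ (D : List (Pair n)) → IsKTupleDominating n k D → m ≤ length D)

-- For a list D of 2-sets write d(x) for the number of members containing the point x and e(x, y)
-- for the number containing both x and y. A 2-set lies in N[ab] iff it contains both or neither
-- of a, b, so |N[ab] ∩ D| + d(a) + d(b) = |D| + 2 e(a, b), and D is k-tuple dominating iff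
-- k + d(a) + d(b) ≤ |D| + 2 e(a, b) for all points a ≠ b.
--
-- Lower bound: let |D| = k + t, s = ⌊t/2⌋ and let x have maximum degree Δ. If Δ ≤ s then
-- 2|D| = Σ d ≤ n s; otherwise summing the inequality over the points y ≠ x, where
-- Σ d(y) = 2|D| − Δ and Σ e(x, y) = Δ, bounds |D| in terms of Δ (for Δ = s + 1 first sharpened
-- pointwise according to whether x and y are joined). For t < 2α under (1), and t ≤ 2α under (2),
-- every case is contradictory; the case Δ = s + 1, t even of (2) fails by parity, which is where
-- α mod 2 enters.
--
-- Upper bound: view D as the edge set of a graph on [n]; only degrees and adjacency matter. For (1)
-- take k + 2α edges of a graph of maximum degree α (a circulant graph, plus a matching when α is
-- odd). For (2) take a complete graph on α + 2 points, whose degrees α + 1 are compensated by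
-- adjacency, and fill up with edges of maximum degree α on the remaining points.

module Submission where

open import Defs
open import Data.Nat using (ℕ; zero; suc; _+_; _*_; _∸_; _%_; _/_; _≤_; _<_; z≤n; s≤s; _≤?_; _<?_)
  renaming (_≟_ to _≟ℕ_)
open import Data.Nat.Properties
open import Data.Nat.DivMod using (m≡m%n+[m/n]*n; m%n<n; m/n*n≤m)
open import Data.Nat.Divisibility using (_∣_; m%n≡0⇒n∣m; ∣m⇒∣m*n; m∣m*n; ∣m+n∣m⇒∣n; ∣1⇒≡1)
open import Data.Nat.Tactic.RingSolver using (solve)
open import Data.Fin using (Fin; toℕ; punchIn)
  renaming (zero to fzero; suc to fsuc; _<_ to _<ᶠ_)
open import Data.Fin.Properties using (punchInᵢ≢i; toℕ<n; any?)
  renaming (_≟_ to _≟ᶠ_; <-cmp to <ᶠ-cmp)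
open import Data.List using (List; []; _∷_; _++_; length; filter; map; take)
open import Data.List.Properties using (length-++; length-map; length-take; length-filter)
open import Data.List.Relation.Unary.All as All using (All)
open import Data.List.Relation.Unary.All.Properties using (++⁺; map⁺; take⁺)
open import Data.List.Relation.Unary.Unique.Propositional using (Unique)
open import Data.List.Relation.Unary.AllPairs as AllPairs using ()
open import Data.Product using (Σ; _×_; _,_; proj₁; proj₂; ∃)
open import Data.Product.Properties using (≡-dec)
open import Data.Sum using (_⊎_; inj₁; inj₂; [_,_]′)
open import Data.Empty using (⊥; ⊥-elim)
open import Function using (_∘_)
open import Relation.Nullary using (Dec; yes; no; ¬_)
open import Relation.Nullary.Decidable using (_⊎-dec_)
open import Relation.Binary.Definitions using (DecidableEquality; tri<; tri≈; tri>)
open import Relation.Binary.PropositionalEquality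
open import Algebra.Properties.Semiring.Sum +-*-semiring
  using (sum; sum-syntax; sum-cong-≗; ∑-distrib-+; *-distribˡ-sum; sum-remove)
open import Algebra.Properties.CommutativeSemigroup +-commutativeSemigroup using (interchange)

𝟙 : ∀ {p} {P : Set p} → Dec P → ℕ
𝟙 (yes _) = 1
𝟙 (no _) = 0

𝟙-yes : ∀ {p} {P : Set p} (d : Dec P) → P → 𝟙 d ≡ 1
𝟙-yes (yes _) _ = refl
𝟙-yes (no ¬p) p = ⊥-elim (¬p p)

𝟙-no : ∀ {p} {P : Set p} (d : Dec P) → ¬ P → 𝟙 d ≡ 0
𝟙-no (yes p) ¬p = ⊥-elim (¬p p)
𝟙-no (no _) _ = refl

𝟙-mono : ∀ {p q} {P : Set p} {Q : Set q} (d : Dec P) (e : Dec Q) → (P → Q) → 𝟙 d ≤ 𝟙 e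
𝟙-mono (yes p) e f = ≤-reflexive (sym (𝟙-yes e (f p)))
𝟙-mono (no _) e f = z≤n

𝟙≤1 : ∀ {p} {P : Set p} (d : Dec P) → 𝟙 d ≤ 1
𝟙≤1 (yes _) = ≤-refl
𝟙≤1 (no _) = z≤n

𝟙-idem : ∀ {p} {P : Set p} (d : Dec P) → 𝟙 d * 𝟙 d ≡ 𝟙 d
𝟙-idem (yes _) = refl
𝟙-idem (no _) = refl

𝟙-⊎ : ∀ {p q} {P : Set p} {Q : Set q} (d : Dec P) (e : Dec Q) → (P → Q → ⊥) → 𝟙 (d ⊎-dec e) ≡ 𝟙 d + 𝟙 e
𝟙-⊎ (yes p) (yes q) h = ⊥-elim (h p q)
𝟙-⊎ (yes _) (no _) h = refl
𝟙-⊎ (no _) (yes _) h = refl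
𝟙-⊎ (no _) (no _) h = refl

𝟙-⊎-≤ : ∀ {p q} {P : Set p} {Q : Set q} (d : Dec P) (e : Dec Q) → 𝟙 (d ⊎-dec e) ≤ 𝟙 d + 𝟙 e
𝟙-⊎-≤ (yes _) _ = s≤s z≤n
𝟙-⊎-≤ (no _) (yes _) = ≤-refl
𝟙-⊎-≤ (no _) (no _) = z≤n

sumBy : ∀ {a} {A : Set a} → (A → ℕ) → List A → ℕ
sumBy f [] = 0
sumBy f (x ∷ xs) = f x + sumBy f xs

module _ {a} {A : Set a} where

  length-filter≡sumBy : ∀ {p} {P : A → Set p} (P? : ∀ x → Dec (P x)) (xs : List A) →
    length (filter P? xs) ≡ sumBy (𝟙 ∘ P?) xs
  length-filter≡sumBy P? [] = refl
  length-filter≡sumBy P? (x ∷ xs) with P? x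
  ... | yes _ = cong suc (length-filter≡sumBy P? xs)
  ... | no _ = length-filter≡sumBy P? xs

  sumBy-cong : ∀ {f g : A → ℕ} {xs} → All (λ x → f x ≡ g x) xs → sumBy f xs ≡ sumBy g xs
  sumBy-cong All.[] = refl
  sumBy-cong (e All.∷ es) = cong₂ _+_ e (sumBy-cong es)

  sumBy-mono : ∀ {f g : A → ℕ} {xs} → All (λ x → f x ≤ g x) xs → sumBy f xs ≤ sumBy g xs
  sumBy-mono All.[] = z≤n
  sumBy-mono (le All.∷ les) = +-mono-≤ le (sumBy-mono les)

  sumBy-+ : ∀ (f g : A → ℕ) xs → sumBy (λ x → f x + g x) xs ≡ sumBy f xs + sumBy g xs
  sumBy-+ f g [] = refl
  sumBy-+ f g (x ∷ xs) rewrite sumBy-+ f g xs = interchange (f x) (g x) (sumBy f xs) (sumBy g xs)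

  sumBy-* : ∀ c (f : A → ℕ) xs → sumBy (λ x → c * f x) xs ≡ c * sumBy f xs
  sumBy-* c f [] = sym (*-zeroʳ c)
  sumBy-* c f (x ∷ xs) rewrite sumBy-* c f xs = sym (*-distribˡ-+ c (f x) (sumBy f xs))

  sumBy-1≡length : (xs : List A) → sumBy (λ _ → 1) xs ≡ length xs
  sumBy-1≡length [] = refl
  sumBy-1≡length (x ∷ xs) = cong suc (sumBy-1≡length xs)

  sumBy-++ : ∀ (f : A → ℕ) xs ys → sumBy f (xs ++ ys) ≡ sumBy f xs + sumBy f ys
  sumBy-++ f [] ys = refl
  sumBy-++ f (x ∷ xs) ys rewrite sumBy-++ f xs ys = sym (+-assoc (f x) (sumBy f xs) (sumBy f ys))

  sumBy-map : ∀ {b} {B : Set b} (f : B → ℕ) (g : A → B) xs → sumBy f (map g xs) ≡ sumBy (f ∘ g) xs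
  sumBy-map f g [] = refl
  sumBy-map f g (x ∷ xs) = cong (f (g x) +_) (sumBy-map f g xs)

  sumBy-take : ∀ (f : A → ℕ) M xs → sumBy f (take M xs) ≤ sumBy f xs
  sumBy-take f zero xs = z≤n
  sumBy-take f (suc M) [] = z≤n
  sumBy-take f (suc M) (x ∷ xs) = +-monoʳ-≤ (f x) (sumBy-take f M xs)

  sumBy≤sumBy-take-++ : ∀ (f : A → ℕ) M xs ys → length xs ≤ M → sumBy f xs ≤ sumBy f (take M (xs ++ ys))
  sumBy≤sumBy-take-++ f M [] ys _ = z≤n
  sumBy≤sumBy-take-++ f (suc M) (x ∷ xs) ys (s≤s le) = +-monoʳ-≤ (f x) (sumBy≤sumBy-take-++ f M xs ys le)

∑-mono : ∀ {n} {f g : Fin n → ℕ} → (∀ i → f i ≤ g i) → sum f ≤ sum g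
∑-mono {zero} h = z≤n
∑-mono {suc n} h = +-mono-≤ (h fzero) (∑-mono (h ∘ fsuc))

∑-const : ∀ n c → ∑[ i < n ] c ≡ n * c
∑-const zero c = refl
∑-const (suc n) c = cong (c +_) (∑-const n c)

∑-sumBy-comm : ∀ {a} {A : Set a} n (g : Fin n → A → ℕ) xs →
  ∑[ i < n ] sumBy (g i) xs ≡ sumBy (λ u → ∑[ i < n ] g i u) xs
∑-sumBy-comm n g [] = trans (∑-const n 0) (*-zeroʳ n)
∑-sumBy-comm n g (x ∷ xs) = trans (∑-distrib-+ (λ i → g i x) (λ i → sumBy (g i) xs))
  (cong (∑[ i < n ] g i x +_) (∑-sumBy-comm n g xs))

∑-𝟙-≡ : ∀ {n} (c : Fin n) → ∑[ i < n ] 𝟙 (c ≟ᶠ i) ≡ 1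
∑-𝟙-≡ {suc n} c = begin
  ∑[ i < suc n ] 𝟙 (c ≟ᶠ i)                    ≡⟨ sum-remove {i = c} (λ i → 𝟙 (c ≟ᶠ i)) ⟩
  𝟙 (c ≟ᶠ c) + ∑[ j < n ] 𝟙 (c ≟ᶠ punchIn c j)
    ≡⟨ cong₂ _+_ (𝟙-yes (c ≟ᶠ c) refl) (sum-cong-≗ (λ j → 𝟙-no (c ≟ᶠ punchIn c j) (punchInᵢ≢i c j ∘ sym))) ⟩
  1 + ∑[ j < n ] 0                              ≡⟨ cong suc (trans (∑-const n 0) (*-zeroʳ n)) ⟩
  1                                             ∎
  where open ≡-Reasoning

sumBy≡0⇒All≡0 : ∀ {a} {A : Set a} (f : A → ℕ) xs → sumBy f xs ≡ 0 → All (λ x → f x ≡ 0) xs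
sumBy≡0⇒All≡0 f [] _ = All.[]
sumBy≡0⇒All≡0 f (x ∷ xs) eq = m+n≡0⇒m≡0 (f x) eq All.∷ sumBy≡0⇒All≡0 f xs (m+n≡0⇒n≡0 (f x) eq)

count≤1⇒Unique : ∀ {a} {A : Set a} (_≟_ : DecidableEquality A) (xs : List A) →
  (∀ q → sumBy (λ u → 𝟙 (u ≟ q)) xs ≤ 1) → Unique xs
count≤1⇒Unique _≟_ [] _ = AllPairs.[]
count≤1⇒Unique _≟_ (x ∷ xs) count≤1 =
  All.map (λ {u} u≢x x≡u → 1+n≢0 (trans (sym (𝟙-yes (u ≟ x) (sym x≡u))) u≢x)) (sumBy≡0⇒All≡0 _ xs count[x]≡0)
  AllPairs.∷ count≤1⇒Unique _≟_ xs (λ q → ≤-trans (m≤n+m _ _) (count≤1 q))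
  where
  count[x]≡0 : sumBy (λ u → 𝟙 (u ≟ x)) xs ≡ 0
  count[x]≡0 = n≤0⇒n≡0 (+-cancelˡ-≤ 1 _ 0
    (subst (λ c → c + sumBy (λ u → 𝟙 (u ≟ x)) xs ≤ 1) (𝟙-yes (x ≟ x) refl) (count≤1 x)))

sumUpTo : ℕ → (ℕ → ℕ) → ℕ
sumUpTo zero f = 0
sumUpTo (suc L) f = f L + sumUpTo L f

sumUpTo-≡0 : ∀ L (f : ℕ → ℕ) → (∀ p → p < L → f p ≡ 0) → sumUpTo L f ≡ 0
sumUpTo-≡0 zero f h = refl
sumUpTo-≡0 (suc L) f h = cong₂ _+_ (h L ≤-refl) (sumUpTo-≡0 L f (λ p p<L → h p (m<n⇒m<1+n p<L)))

term≤sumUpTo : ∀ L (f : ℕ → ℕ) p → p < L → f p ≤ sumUpTo L f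
term≤sumUpTo (suc L) f p p<1+L with p ≟ℕ L
... | yes refl = m≤m+n (f p) _
... | no p≢L = ≤-trans (term≤sumUpTo L f p (≤∧≢⇒< (≤-pred p<1+L) p≢L)) (m≤n+m _ (f L))

sumUpTo-+ : ∀ L (f g : ℕ → ℕ) → sumUpTo L (λ p → f p + g p) ≡ sumUpTo L f + sumUpTo L g
sumUpTo-+ zero f g = refl
sumUpTo-+ (suc L) f g rewrite sumUpTo-+ L f g = interchange (f L) (g L) (sumUpTo L f) (sumUpTo L g)

sumUpTo-mono : ∀ L (f g : ℕ → ℕ) → (∀ p → p < L → f p ≤ g p) → sumUpTo L f ≤ sumUpTo L g
sumUpTo-mono zero f g h = z≤n
sumUpTo-mono (suc L) f g h = +-mono-≤ (h L ≤-refl) (sumUpTo-mono L f g (λ p p<L → h p (m<n⇒m<1+n p<L)))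

sumUpTo-𝟙-injective : ∀ L (g : ℕ → ℕ) y → (∀ i j → i < L → j < L → g i ≡ g j → i ≡ j) →
  sumUpTo L (λ i → 𝟙 (g i ≟ℕ y)) ≤ 1
sumUpTo-𝟙-injective zero g y inj = z≤n
sumUpTo-𝟙-injective (suc L) g y inj with g L ≟ℕ y
... | yes gL≡y = ≤-reflexive (cong suc (sumUpTo-≡0 L _ (λ p p<L → 𝟙-no (g p ≟ℕ y)
      (λ gp≡y → <-irrefl (inj p L (m<n⇒m<1+n p<L) ≤-refl (trans gp≡y (sym gL≡y))) p<L))))
... | no _ = sumUpTo-𝟙-injective L g y (λ i j i<L j<L → inj i j (m<n⇒m<1+n i<L) (m<n⇒m<1+n j<L))

sumUpTo-𝟙-≡0 : ∀ L (g : ℕ → ℕ) y → (∀ i → i < L → g i ≢ y) → sumUpTo L (λ i → 𝟙 (g i ≟ℕ y)) ≡ 0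
sumUpTo-𝟙-≡0 L g y h = sumUpTo-≡0 L _ (λ p p<L → 𝟙-no (g p ≟ℕ y) (h p p<L))

-- Degrees and the closed-neighbourhood identity

module _ {n : ℕ} where

  _∈ₚ_ : Fin n → Pair n → Set
  y ∈ₚ (c , d) = c ≡ y ⊎ d ≡ y

  _∈ₚ?_ : (y : Fin n) (u : Pair n) → Dec (y ∈ₚ u)
  y ∈ₚ? (c , d) = (c ≟ᶠ y) ⊎-dec (d ≟ᶠ y)

  deg : Fin n → List (Pair n) → ℕ
  deg y = sumBy (λ u → 𝟙 (y ∈ₚ? u))

  codeg : Fin n → Fin n → List (Pair n) → ℕ
  codeg x y = sumBy (λ u → 𝟙 (x ∈ₚ? u) * 𝟙 (y ∈ₚ? u))

  <ᶠ⇒≢ : ∀ {a b : Fin n} → a <ᶠ b → a ≢ b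
  <ᶠ⇒≢ a<b refl = <-irrefl refl a<b

  ∑-𝟙-∈ : (u : Pair n) → IsVertex u → ∑[ y < n ] 𝟙 (y ∈ₚ? u) ≡ 2
  ∑-𝟙-∈ (c , d) c<d = begin
    ∑[ y < n ] 𝟙 (y ∈ₚ? (c , d))
      ≡⟨ sum-cong-≗ (λ y → 𝟙-⊎ (c ≟ᶠ y) (d ≟ᶠ y) (λ p q → <ᶠ⇒≢ c<d (trans p (sym q)))) ⟩
    ∑[ y < n ] (𝟙 (c ≟ᶠ y) + 𝟙 (d ≟ᶠ y))
      ≡⟨ ∑-distrib-+ (λ y → 𝟙 (c ≟ᶠ y)) (λ y → 𝟙 (d ≟ᶠ y)) ⟩
    ∑[ y < n ] 𝟙 (c ≟ᶠ y) + ∑[ y < n ] 𝟙 (d ≟ᶠ y) ≡⟨ cong₂ _+_ (∑-𝟙-≡ c) (∑-𝟙-≡ d) ⟩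
    2                                             ∎
    where open ≡-Reasoning

  ∑-deg≡2*length : (D : List (Pair n)) → All IsVertex D → ∑[ y < n ] deg y D ≡ 2 * length D
  ∑-deg≡2*length D vD = begin
    ∑[ y < n ] deg y D                        ≡⟨ ∑-sumBy-comm n (λ y u → 𝟙 (y ∈ₚ? u)) D ⟩
    sumBy (λ u → ∑[ y < n ] 𝟙 (y ∈ₚ? u)) D   ≡⟨ sumBy-cong (All.map (λ {u} → ∑-𝟙-∈ u) vD) ⟩
    sumBy (λ _ → 2 * 1) D                     ≡⟨ sumBy-* 2 (λ _ → 1) D ⟩
    2 * sumBy (λ _ → 1) D                     ≡⟨ cong (2 *_) (sumBy-1≡length D) ⟩
    2 * length D                              ∎
    where open ≡-Reasoning

  ∑-codeg≡2*deg : ∀ x (D : List (Pair n)) → All IsVertex D → ∑[ y < n ] codeg x y D ≡ 2 * deg x D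
  ∑-codeg≡2*deg x D vD = begin
    ∑[ y < n ] codeg x y D                                     ≡⟨ ∑-sumBy-comm n (λ y u → 𝟙 (x ∈ₚ? u) * 𝟙 (y ∈ₚ? u)) D ⟩
    sumBy (λ u → ∑[ y < n ] (𝟙 (x ∈ₚ? u) * 𝟙 (y ∈ₚ? u))) D   ≡⟨ sumBy-cong (All.map (λ {u} vu → per-pair u vu) vD) ⟩
    sumBy (λ u → 2 * 𝟙 (x ∈ₚ? u)) D                           ≡⟨ sumBy-* 2 (λ u → 𝟙 (x ∈ₚ? u)) D ⟩
    2 * deg x D                                                ∎
    where
    open ≡-Reasoning
    per-pair : ∀ u → IsVertex u → ∑[ y < n ] (𝟙 (x ∈ₚ? u) * 𝟙 (y ∈ₚ? u)) ≡ 2 * 𝟙 (x ∈ₚ? u)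
    per-pair u vu = trans (sym (*-distribˡ-sum (𝟙 (x ∈ₚ? u)) (λ y → 𝟙 (y ∈ₚ? u))))
      (trans (cong (𝟙 (x ∈ₚ? u) *_) (∑-𝟙-∈ u vu)) (*-comm (𝟙 (x ∈ₚ? u)) 2))

  codeg-diag : ∀ x (D : List (Pair n)) → codeg x x D ≡ deg x D
  codeg-diag x D = sumBy-cong (All.universal (λ u → 𝟙-idem (x ∈ₚ? u)) D)

  codeg-comm : ∀ x y (D : List (Pair n)) → codeg x y D ≡ codeg y x D
  codeg-comm x y D = sumBy-cong (All.universal (λ u → *-comm (𝟙 (x ∈ₚ? u)) (𝟙 (y ∈ₚ? u))) D)

  private
    inNbhd-∈→∈ : ∀ {a b} (u : Pair n) → InClosedNbhd (a , b) u → a ∈ₚ u → b ∈ₚ u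
    inNbhd-∈→∈ _ (inj₁ refl) _ = inj₂ refl
    inNbhd-∈→∈ _ (inj₂ ((c≢a , _) , (d≢a , _))) = [ ⊥-elim ∘ c≢a , ⊥-elim ∘ d≢a ]′

    inNbhd-∈←∈ : ∀ {a b} (u : Pair n) → InClosedNbhd (a , b) u → b ∈ₚ u → a ∈ₚ u
    inNbhd-∈←∈ _ (inj₁ refl) _ = inj₁ refl
    inNbhd-∈←∈ _ (inj₂ ((_ , c≢b) , (_ , d≢b))) = [ ⊥-elim ∘ c≢b , ⊥-elim ∘ d≢b ]′

    both⇒inNbhd : ∀ {a b} (u : Pair n) → a <ᶠ b → IsVertex u → a ∈ₚ u → b ∈ₚ u → InClosedNbhd (a , b) u
    both⇒inNbhd _ a<b c<d (inj₁ refl) (inj₁ refl) = ⊥-elim (<ᶠ⇒≢ a<b refl)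
    both⇒inNbhd _ a<b c<d (inj₁ refl) (inj₂ refl) = inj₁ refl
    both⇒inNbhd _ a<b c<d (inj₂ refl) (inj₁ refl) = ⊥-elim (<-asym a<b c<d)
    both⇒inNbhd _ a<b c<d (inj₂ refl) (inj₂ refl) = ⊥-elim (<ᶠ⇒≢ a<b refl)

    neither⇒inNbhd : ∀ {a b} (u : Pair n) → ¬ a ∈ₚ u → ¬ b ∈ₚ u → InClosedNbhd (a , b) u
    neither⇒inNbhd _ a∉ b∉ = inj₂ ((a∉ ∘ inj₁ , b∉ ∘ inj₁) , (a∉ ∘ inj₂ , b∉ ∘ inj₂))

    𝟙-inNbhd : ∀ a b → a <ᶠ b → (u : Pair n) → IsVertex u →
      𝟙 (inClosedNbhd? (a , b) u) + 𝟙 (a ∈ₚ? u) + 𝟙 (b ∈ₚ? u) ≡ 1 + 2 * (𝟙 (a ∈ₚ? u) * 𝟙 (b ∈ₚ? u))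
    𝟙-inNbhd a b a<b u vu with a ∈ₚ? u | b ∈ₚ? u
    ... | yes a∈ | yes b∈ rewrite 𝟙-yes (inClosedNbhd? (a , b) u) (both⇒inNbhd u a<b vu a∈ b∈) = refl
    ... | no a∉ | no b∉ rewrite 𝟙-yes (inClosedNbhd? (a , b) u) (neither⇒inNbhd u a∉ b∉) = refl
    ... | yes a∈ | no b∉ rewrite 𝟙-no (inClosedNbhd? (a , b) u) (λ N → b∉ (inNbhd-∈→∈ u N a∈)) = refl
    ... | no a∉ | yes b∈ rewrite 𝟙-no (inClosedNbhd? (a , b) u) (λ N → a∉ (inNbhd-∈←∈ u N b∈)) = refl

  nbhdCount+deg+deg≡length+2*codeg : ∀ a b → a <ᶠ b → (D : List (Pair n)) → All IsVertex D →
    nbhdCount (a , b) D + deg a D + deg b D ≡ length D + 2 * codeg a b D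
  nbhdCount+deg+deg≡length+2*codeg a b a<b D vD = begin
    nbhdCount (a , b) D + deg a D + deg b D
      ≡⟨ cong (λ z → z + deg a D + deg b D) (length-filter≡sumBy (inClosedNbhd? (a , b)) D) ⟩
    sumBy (λ u → 𝟙 (inClosedNbhd? (a , b) u)) D + deg a D + deg b D
      ≡⟨ cong (_+ deg b D) (sym (sumBy-+ _ _ D)) ⟩
    sumBy (λ u → 𝟙 (inClosedNbhd? (a , b) u) + 𝟙 (a ∈ₚ? u)) D + deg b D
      ≡⟨ sym (sumBy-+ _ _ D) ⟩
    sumBy (λ u → 𝟙 (inClosedNbhd? (a , b) u) + 𝟙 (a ∈ₚ? u) + 𝟙 (b ∈ₚ? u)) D
      ≡⟨ sumBy-cong (All.map (λ {u} → 𝟙-inNbhd a b a<b u) vD) ⟩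
    sumBy (λ u → 1 + 2 * (𝟙 (a ∈ₚ? u) * 𝟙 (b ∈ₚ? u))) D
      ≡⟨ sumBy-+ _ _ D ⟩
    sumBy (λ _ → 1) D + sumBy (λ u → 2 * (𝟙 (a ∈ₚ? u) * 𝟙 (b ∈ₚ? u))) D
      ≡⟨ cong₂ _+_ (sumBy-1≡length D) (sumBy-* 2 _ D) ⟩
    length D + 2 * codeg a b D ∎
    where open ≡-Reasoning

-- The lower bound

private
  cancel-≤ : ∀ a b c {b′ c′} → b′ ≤ c′ → b′ ≡ a + b → c′ ≡ a + c → b ≤ c
  cancel-≤ a b c h refl refl = +-cancelˡ-≤ a b c h

  -- at the point x of degree Δ = s + 1: if x, y are not joined (e = 0) then d(y) ≤ s
  odd-step : ∀ s t Δ dy e → t ≡ 1 + 2 * s → Δ ≡ suc s → dy ≤ suc s → Δ + dy ≤ t + 2 * e → 0 + dy ≤ s + 1 * e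
  odd-step s _ _ dy zero refl refl _ h = ≤-trans (cancel-≤ (suc s) dy s h refl (solve (s ∷ []))) (m≤m+n s 0)
  odd-step s _ _ dy (suc e) refl refl dy≤ _ =
    ≤-trans dy≤ (≤-trans (s≤s (m≤m+n s (e + 0))) (≤-reflexive (sym (+-suc s (e + 0)))))

  even-step : ∀ s t Δ dy e → t ≡ 2 * s → Δ ≡ suc s → dy ≤ suc s → Δ + dy ≤ t + 2 * e → 1 + dy ≤ s + 2 * e
  even-step s _ _ dy zero refl refl _ h = cancel-≤ s (suc dy) (s + 0) h (solve (s ∷ dy ∷ [])) (solve (s ∷ []))
  even-step s _ _ dy (suc e) refl refl dy≤ _ =
    ≤-trans (s≤s dy≤) (≤-trans (≤-reflexive (+-comm 2 s)) (+-monoʳ-≤ s (*-monoʳ-≤ 2 (s≤s z≤n))))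

  Δ≤s-arith : ∀ r k t s → 2 * s ≤ t → 2 * (k + t) ≤ (4 + r) * s → 2 * k ≤ r * s
  Δ≤s-arith r k t s 2s≤t h = cancel-≤ (4 * s) (2 * k) (r * s) (begin
    2 * k + 2 * (2 * s) ≤⟨ +-monoʳ-≤ (2 * k) (*-monoʳ-≤ 2 2s≤t) ⟩
    2 * k + 2 * t       ≡⟨ solve (k ∷ t ∷ []) ⟩
    2 * (k + t)         ≤⟨ h ⟩
    (4 + r) * s         ∎) (solve (k ∷ s ∷ [])) (solve (r ∷ s ∷ []))
    where open ≤-Reasoning

  Δ≥s+2-arith : ∀ r k t Δ S → Δ + S ≡ 2 * (k + t) → (3 + r) * Δ + S ≤ (3 + r) * t + 2 * Δ →
    r * Δ + 2 * k ≤ (1 + r) * t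
  Δ≥s+2-arith r k t Δ S split h = cancel-≤ (3 * Δ + 2 * t) (r * Δ + 2 * k) ((1 + r) * t) (begin
    (3 + r) * Δ + 2 * (k + t) ≡⟨ cong ((3 + r) * Δ +_) split ⟨
    (3 + r) * Δ + (Δ + S)     ≡⟨ solve (r ∷ Δ ∷ S ∷ []) ⟩
    Δ + ((3 + r) * Δ + S)     ≤⟨ +-monoʳ-≤ Δ h ⟩
    Δ + ((3 + r) * t + 2 * Δ) ∎) (solve (r ∷ k ∷ t ∷ Δ ∷ [])) (solve (r ∷ t ∷ Δ ∷ []))
    where open ≤-Reasoning

  Δ≡s+1-odd-arith : ∀ r k t s Δ S → t ≡ 1 + 2 * s → Δ ≡ suc s → Δ + S ≡ 2 * (k + t) →
    (3 + r) * 0 + S ≤ (3 + r) * s + 1 * Δ → 2 * k ≤ (1 + r) * s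
  Δ≡s+1-odd-arith r k _ s _ S refl refl split h = cancel-≤ (4 * s + 2) (2 * k) ((1 + r) * s) (begin
    2 * (k + (1 + 2 * s))           ≡⟨ split ⟨
    suc s + S                       ≡⟨ solve (r ∷ s ∷ S ∷ []) ⟩
    suc s + ((3 + r) * 0 + S)       ≤⟨ +-monoʳ-≤ (suc s) h ⟩
    suc s + ((3 + r) * s + 1 * suc s) ∎) (solve (k ∷ s ∷ [])) (solve (r ∷ s ∷ []))
    where open ≤-Reasoning

  Δ≡s+1-even-arith : ∀ r k t s Δ S → t ≡ 2 * s → Δ ≡ suc s → Δ + S ≡ 2 * (k + t) →
    (3 + r) * 1 + S ≤ (3 + r) * s + 2 * Δ → 2 * k + r ≤ (2 + r) * s
  Δ≡s+1-even-arith r k _ s _ S refl refl split h = cancel-≤ (4 * s + 3) (2 * k + r) ((2 + r) * s) (begin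
    (3 + r) * 1 + 2 * (k + 2 * s)     ≡⟨ cong ((3 + r) * 1 +_) split ⟨
    (3 + r) * 1 + (suc s + S)         ≡⟨ solve (r ∷ s ∷ S ∷ []) ⟩
    suc s + ((3 + r) * 1 + S)         ≤⟨ +-monoʳ-≤ (suc s) h ⟩
    suc s + ((3 + r) * s + 2 * suc s) ∎) (solve (r ∷ k ∷ s ∷ [])) (solve (r ∷ s ∷ []))
    where open ≤-Reasoning

parity : ∀ t → ∃ λ s → t ≡ 2 * s ⊎ t ≡ 1 + 2 * s
parity zero = 0 , inj₁ refl
parity (suc t) with parity t
... | s , inj₁ t≡2s = s , inj₂ (cong suc t≡2s)
... | s , inj₂ t≡1+2s = suc s , inj₁ (trans (cong suc t≡1+2s) (solve (s ∷ [])))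

private
  parity⇒2s≤t : ∀ {t} s → t ≡ 2 * s ⊎ t ≡ 1 + 2 * s → 2 * s ≤ t
  parity⇒2s≤t _ (inj₁ refl) = ≤-refl
  parity⇒2s≤t _ (inj₂ refl) = n≤1+n _

  parity⇒t≤1+2s : ∀ {t} s → t ≡ 2 * s ⊎ t ≡ 1 + 2 * s → t ≤ 1 + 2 * s
  parity⇒t≤1+2s _ (inj₁ refl) = n≤1+n _
  parity⇒t≤1+2s _ (inj₂ refl) = ≤-refl

  twice-≤-+ : ∀ {t a b} → t ≤ a → t ≤ b → 2 * t ≤ a + b
  twice-≤-+ {t} {a} {b} t≤a t≤b = subst (_≤ a + b) (cong (t +_) (sym (+-identityʳ t))) (+-mono-≤ t≤a t≤b)

-- the cases by the maximum degree Δ, already simplified, for n = 4 + r points, |D| = k + t and t ∈ {2s, 2s + 1}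
data DegreeCase (r k t s : ℕ) : Set where
  Δ≤s        : 2 * k ≤ r * s → DegreeCase r k t s
  Δ≥s+2      : r * (2 + s) + 2 * k ≤ (1 + r) * t → DegreeCase r k t s
  Δ≡s+1-odd  : t ≡ 1 + 2 * s → 2 * k ≤ (1 + r) * s → DegreeCase r k t s
  Δ≡s+1-even : t ≡ 2 * s → 2 * k + r ≤ (2 + r) * s → DegreeCase r k t s

module _ {r k t : ℕ} (D : List (Pair (4 + r))) (vD : All IsVertex D)
         (dom : ∀ v → IsVertex v → k ≤ nbhdCount v D) (|D|≡k+t : length D ≡ k + t) where

  private
    d : Fin (4 + r) → ℕ
    d y = deg y D

    e : Fin (4 + r) → Fin (4 + r) → ℕ
    e x y = codeg x y D

    ∑≠ : Fin (4 + r) → (Fin (4 + r) → ℕ) → ℕ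
    ∑≠ x f = ∑[ j < 3 + r ] f (punchIn x j)

    excess-bound< : ∀ x y → x <ᶠ y → d x + d y ≤ t + 2 * e x y
    excess-bound< x y x<y = +-cancelˡ-≤ k _ _ (begin
      k + (d x + d y)                   ≡⟨ +-assoc k (d x) (d y) ⟨
      k + d x + d y                     ≤⟨ +-monoˡ-≤ (d y) (+-monoˡ-≤ (d x) (dom (x , y) x<y)) ⟩
      nbhdCount (x , y) D + d x + d y   ≡⟨ nbhdCount+deg+deg≡length+2*codeg x y x<y D vD ⟩
      length D + 2 * e x y              ≡⟨ cong (_+ 2 * e x y) |D|≡k+t ⟩
      k + t + 2 * e x y                 ≡⟨ +-assoc k t (2 * e x y) ⟩
      k + (t + 2 * e x y)               ∎)
      where open ≤-Reasoning

    excess-bound : ∀ x y → x ≢ y → d x + d y ≤ t + 2 * e x y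
    excess-bound x y x≢y with <ᶠ-cmp x y
    ... | tri< x<y _ _ = excess-bound< x y x<y
    ... | tri≈ _ x≡y _ = ⊥-elim (x≢y x≡y)
    ... | tri> _ _ y<x = subst₂ _≤_ (+-comm (d y) (d x)) (cong (λ z → t + 2 * z) (codeg-comm y x D))
                                (excess-bound< y x y<x)

    deg+∑≠deg : ∀ x → d x + ∑≠ x d ≡ 2 * (k + t)
    deg+∑≠deg x = trans (sym (sum-remove {i = x} d)) (trans (∑-deg≡2*length D vD) (cong (2 *_) |D|≡k+t))

    ∑≠codeg : ∀ x → ∑≠ x (e x) ≡ d x
    ∑≠codeg x = +-cancelˡ-≡ (d x) _ _ (begin
      d x + ∑≠ x (e x)     ≡⟨ cong (_+ ∑≠ x (e x)) (codeg-diag x D) ⟨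
      e x x + ∑≠ x (e x)   ≡⟨ sum-remove {i = x} (e x) ⟨
      ∑[ y < 4 + r ] e x y ≡⟨ ∑-codeg≡2*deg x D vD ⟩
      2 * d x              ≡⟨ cong (d x +_) (+-identityʳ (d x)) ⟩
      d x + d x            ∎)
      where open ≡-Reasoning

    ∑≠-bound : ∀ x a b c → (∀ y → x ≢ y → a + d y ≤ b + c * e x y) →
      (3 + r) * a + ∑≠ x d ≤ (3 + r) * b + c * d x
    ∑≠-bound x a b c h = begin
      (3 + r) * a + ∑≠ x d                                       ≡⟨ cong (_+ ∑≠ x d) (∑-const (3 + r) a) ⟨
      ∑[ j < 3 + r ] a + ∑≠ x d                                  ≡⟨ ∑-distrib-+ (λ _ → a) (d ∘ punchIn x) ⟨
      ∑[ j < 3 + r ] (a + d (punchIn x j))                       ≤⟨ ∑-mono (λ j → h (punchIn x j) (punchInᵢ≢i x j ∘ sym)) ⟩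
      ∑[ j < 3 + r ] (b + c * e x (punchIn x j))                 ≡⟨ ∑-distrib-+ (λ _ → b) (λ j → c * e x (punchIn x j)) ⟩
      ∑[ j < 3 + r ] b + ∑[ j < 3 + r ] (c * e x (punchIn x j))
        ≡⟨ cong₂ _+_ (∑-const (3 + r) b) (sym (*-distribˡ-sum c (e x ∘ punchIn x))) ⟩
      (3 + r) * b + c * ∑≠ x (e x)                               ≡⟨ cong (λ z → (3 + r) * b + c * z) (∑≠codeg x) ⟩
      (3 + r) * b + c * d x                                      ∎
      where open ≤-Reasoning

    ∑-deg≤ : ∀ c → (∀ y → d y ≤ c) → 2 * (k + t) ≤ (4 + r) * c
    ∑-deg≤ c d≤c = begin
      2 * (k + t)          ≡⟨ cong (2 *_) |D|≡k+t ⟨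
      2 * length D         ≡⟨ ∑-deg≡2*length D vD ⟨
      ∑[ y < 4 + r ] d y   ≤⟨ ∑-mono d≤c ⟩
      ∑[ y < 4 + r ] c     ≡⟨ ∑-const (4 + r) c ⟩
      (4 + r) * c          ∎
      where open ≤-Reasoning

  degreeCase : ∀ s → t ≡ 2 * s ⊎ t ≡ 1 + 2 * s → DegreeCase r k t s
  degreeCase s par with any? (λ x → 2 + s ≤? d x)
  ... | yes (x , 2+s≤Δ) = Δ≥s+2 (≤-trans (+-monoˡ-≤ (2 * k) (*-monoʳ-≤ r 2+s≤Δ))
    (Δ≥s+2-arith r k t (d x) (∑≠ x d) (deg+∑≠deg x) (∑≠-bound x (d x) t 2 (excess-bound x))))
  ... | no ¬Δ≥s+2 with any? (λ x → 1 + s ≤? d x)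
  ...   | yes (x , 1+s≤Δ) = Δ≡s+1 par
    where
    d≤s+1 : ∀ y → d y ≤ suc s
    d≤s+1 y = ≤-pred (≰⇒> (λ le → ¬Δ≥s+2 (y , le)))
    Δ≡ : d x ≡ suc s
    Δ≡ = ≤-antisym (d≤s+1 x) 1+s≤Δ
    Δ≡s+1 : t ≡ 2 * s ⊎ t ≡ 1 + 2 * s → DegreeCase r k t s
    Δ≡s+1 (inj₁ t≡2s) = Δ≡s+1-even t≡2s (Δ≡s+1-even-arith r k t s (d x) (∑≠ x d) t≡2s Δ≡ (deg+∑≠deg x)
      (∑≠-bound x 1 s 2 (λ y x≢y → even-step s t (d x) (d y) (e x y) t≡2s Δ≡ (d≤s+1 y) (excess-bound x y x≢y))))
    Δ≡s+1 (inj₂ t≡1+2s) = Δ≡s+1-odd t≡1+2s (Δ≡s+1-odd-arith r k t s (d x) (∑≠ x d) t≡1+2s Δ≡ (deg+∑≠deg x)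
      (∑≠-bound x 0 s 1 (λ y x≢y → odd-step s t (d x) (d y) (e x y) t≡1+2s Δ≡ (d≤s+1 y) (excess-bound x y x≢y))))
  ...   | no ¬Δ≥s+1 =
    Δ≤s (Δ≤s-arith r k t s (parity⇒2s≤t s par) (∑-deg≤ s (λ y → ≤-pred (≰⇒> (λ le → ¬Δ≥s+1 (y , le))))))

¬DegreeCase₁ : ∀ A r k t s → 2 * A + 1 ≤ r → A * (1 + r) < 2 * k → t ≤ 2 * A + 1 →
  t ≡ 2 * s ⊎ t ≡ 1 + 2 * s → ¬ DegreeCase r k t s
¬DegreeCase₁ A r k t s 2A+1≤r A[1+r]<2k t≤2A+1 par = refute
  where
  open ≤-Reasoning
  s≤A : s ≤ A
  s≤A = ≤-pred (*-cancelˡ-< 2 s (suc A) (begin-strict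
    2 * s     ≤⟨ parity⇒2s≤t s par ⟩
    t         ≤⟨ t≤2A+1 ⟩
    2 * A + 1 <⟨ n<1+n _ ⟩
    suc (2 * A + 1) ≡⟨ solve (A ∷ []) ⟩
    2 * suc A ∎))
  A≤r : A ≤ r
  A≤r = ≤-trans (≤-trans (m≤m+n A (A + 0)) (m≤m+n (2 * A) 1)) 2A+1≤r
  t≤s+A+1 : t ≤ s + A + 1
  t≤s+A+1 = *-cancelˡ-≤ 2 (begin
    2 * t                   ≤⟨ twice-≤-+ (parity⇒t≤1+2s s par) t≤2A+1 ⟩
    1 + 2 * s + (2 * A + 1) ≡⟨ solve (s ∷ A ∷ []) ⟩
    2 * (s + A + 1)         ∎)
  t≤r+A : t ≤ r + A
  t≤r+A = ≤-trans t≤2A+1 (≤-trans 2A+1≤r (m≤m+n r A))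
  2k≰A[1+r] : 2 * k ≤ A * (1 + r) → ⊥
  2k≰A[1+r] = <⇒≱ A[1+r]<2k
  refute : DegreeCase r k t s → ⊥
  refute (Δ≤s h) = 2k≰A[1+r] (begin
    2 * k     ≤⟨ h ⟩
    r * s     ≤⟨ *-monoʳ-≤ r s≤A ⟩
    r * A     ≤⟨ m≤n+m (r * A) A ⟩
    A + r * A ≡⟨ solve (A ∷ r ∷ []) ⟩
    A * (1 + r) ∎)
  refute (Δ≥s+2 h) = 2k≰A[1+r] (+-cancelˡ-≤ (r * (2 + s)) _ _ (begin
    r * (2 + s) + 2 * k       ≤⟨ h ⟩
    (1 + r) * t               ≡⟨ solve (r ∷ t ∷ []) ⟩
    t + r * t                 ≤⟨ +-mono-≤ t≤r+A (*-monoʳ-≤ r t≤s+A+1) ⟩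
    r + A + r * (s + A + 1)   ≡⟨ solve (A ∷ r ∷ s ∷ []) ⟩
    r * (2 + s) + A * (1 + r) ∎))
  refute (Δ≡s+1-odd _ h) = 2k≰A[1+r] (begin
    2 * k       ≤⟨ h ⟩
    (1 + r) * s ≤⟨ *-monoʳ-≤ (1 + r) s≤A ⟩
    (1 + r) * A ≡⟨ *-comm (1 + r) A ⟩
    A * (1 + r) ∎)
  refute (Δ≡s+1-even _ h) = <-irrefl refl (begin-strict
    2 * k + r           ≤⟨ h ⟩
    (2 + r) * s         ≤⟨ *-monoʳ-≤ (2 + r) s≤A ⟩
    (2 + r) * A         ≡⟨ solve (A ∷ r ∷ []) ⟩
    A * (1 + r) + A     <⟨ +-monoˡ-< A A[1+r]<2k ⟩
    2 * k + A           ≤⟨ +-monoʳ-≤ (2 * k) A≤r ⟩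
    2 * k + r           ∎)

even*n+1≢2*k : ∀ α r k → α % 2 ≡ 0 → α * r + 1 ≢ 2 * k
even*n+1≢2*k α r k α%2≡0 αr+1≡2k
  with ∣1⇒≡1 (∣m+n∣m⇒∣n (subst (2 ∣_) (sym αr+1≡2k) (m∣m*n k)) (∣m⇒∣m*n r (m%n≡0⇒n∣m α 2 α%2≡0)))
... | ()

¬DegreeCase₂ : ∀ α r k t s → 1 ≤ α → 2 * α + 3 + α % 2 ≤ 4 + r → α * r < 2 * k → t ≤ 2 * α →
  t ≡ 2 * s ⊎ t ≡ 1 + 2 * s → ¬ DegreeCase r k t s
¬DegreeCase₂ α r k t s 1≤α n≥ αr<2k t≤2α par = refute
  where
  open ≤-Reasoning
  2α≤1+r : 2 * α ≤ 1 + r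
  2α≤1+r = cancel-≤ 3 (2 * α) (1 + r) (≤-trans (m≤m+n (2 * α + 3) (α % 2)) n≥) (solve (α ∷ [])) refl
  α≤r : α ≤ r
  α≤r = ≤-pred (≤-trans (≤-reflexive (+-comm 1 α)) (≤-trans (+-monoʳ-≤ α 1≤α)
          (≤-trans (≤-reflexive (cong (α +_) (sym (+-identityʳ α)))) 2α≤1+r)))
  s≤α : s ≤ α
  s≤α = *-cancelˡ-≤ 2 (≤-trans (parity⇒2s≤t s par) t≤2α)
  t≤s+α : t ≤ s + α
  t≤s+α = ≤-pred (*-cancelˡ-< 2 t (suc (s + α)) (begin-strict
    2 * t                 ≤⟨ twice-≤-+ (parity⇒t≤1+2s s par) t≤2α ⟩
    1 + 2 * s + 2 * α     <⟨ n<1+n _ ⟩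
    suc (1 + 2 * s + 2 * α) ≡⟨ solve (s ∷ α ∷ []) ⟩
    2 * suc (s + α)       ∎))
  2k≰αr : 2 * k ≤ α * r → ⊥
  2k≰αr = <⇒≱ αr<2k
  refute : DegreeCase r k t s → ⊥
  refute (Δ≤s h) = 2k≰αr (begin
    2 * k ≤⟨ h ⟩
    r * s ≤⟨ *-monoʳ-≤ r s≤α ⟩
    r * α ≡⟨ *-comm r α ⟩
    α * r ∎)
  refute (Δ≥s+2 h) = 2k≰αr (+-cancelˡ-≤ (r * (2 + s)) _ _ (begin
    r * (2 + s) + 2 * k   ≤⟨ h ⟩
    (1 + r) * t           ≡⟨ solve (r ∷ t ∷ []) ⟩
    t + r * t             ≤⟨ +-mono-≤ (≤-trans t≤2α (*-monoʳ-≤ 2 α≤r)) (*-monoʳ-≤ r t≤s+α) ⟩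
    2 * r + r * (s + α)   ≡⟨ solve (α ∷ r ∷ s ∷ []) ⟩
    r * (2 + s) + α * r   ∎))
  refute (Δ≡s+1-odd t≡1+2s h) = <-irrefl refl (begin-strict
    2 * k + (1 + r)       ≤⟨ +-monoˡ-≤ (1 + r) h ⟩
    (1 + r) * s + (1 + r) ≡⟨ solve (r ∷ s ∷ []) ⟩
    (1 + r) * suc s       ≤⟨ *-monoʳ-≤ (1 + r) s<α ⟩
    (1 + r) * α           ≡⟨ solve (α ∷ r ∷ []) ⟩
    α * r + α             ≤⟨ +-monoʳ-≤ (α * r) α≤r ⟩
    α * r + r             <⟨ +-monoˡ-< r αr<2k ⟩
    2 * k + r             ≤⟨ +-monoʳ-≤ (2 * k) (n≤1+n r) ⟩
    2 * k + (1 + r)       ∎)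
    where
    s<α : s < α
    s<α = *-cancelˡ-< 2 s α (≤-trans (≤-reflexive (sym t≡1+2s)) t≤2α)
  refute (Δ≡s+1-even _ h) = even*n+1≢2*k α r k α%2≡0 (sym 2k≡αr+1)
    where
    2k+r≤2α+αr : 2 * k + r ≤ 2 * α + α * r
    2k+r≤2α+αr = begin
      2 * k + r     ≤⟨ h ⟩
      (2 + r) * s   ≤⟨ *-monoʳ-≤ (2 + r) s≤α ⟩
      (2 + r) * α   ≡⟨ solve (α ∷ r ∷ []) ⟩
      2 * α + α * r ∎
    1+r≡2α : 1 + r ≡ 2 * α
    1+r≡2α = ≤-antisym (+-cancelˡ-≤ (α * r) _ _ (begin
      α * r + (1 + r) ≡⟨ solve (α ∷ r ∷ []) ⟩
      suc (α * r) + r ≤⟨ +-monoˡ-≤ r αr<2k ⟩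
      2 * k + r       ≤⟨ 2k+r≤2α+αr ⟩
      2 * α + α * r   ≡⟨ +-comm (2 * α) (α * r) ⟩
      α * r + 2 * α   ∎)) 2α≤1+r
    α%2≡0 : α % 2 ≡ 0
    α%2≡0 = n≤0⇒n≡0 (+-cancelˡ-≤ (2 * α + 3) (α % 2) 0 (begin
      2 * α + 3 + α % 2 ≤⟨ n≥ ⟩
      3 + (1 + r)       ≡⟨ cong (3 +_) 1+r≡2α ⟩
      3 + 2 * α         ≡⟨ solve (α ∷ []) ⟩
      2 * α + 3 + 0     ∎))
    2k≡αr+1 : 2 * k ≡ α * r + 1
    2k≡αr+1 = trans (≤-antisym (+-cancelʳ-≤ r (2 * k) (1 + α * r) (begin
      2 * k + r         ≤⟨ 2k+r≤2α+αr ⟩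
      2 * α + α * r     ≡⟨ cong (_+ α * r) 1+r≡2α ⟨
      1 + r + α * r     ≡⟨ solve (α ∷ r ∷ []) ⟩
      1 + α * r + r     ∎)) αr<2k) (+-comm 1 (α * r))

k≤length : ∀ {n k} (D : List (Pair (2 + n))) → IsKTupleDominating (2 + n) k D → k ≤ length D
k≤length D (_ , _ , dom) =
  ≤-trans (dom (fzero , fsuc fzero) (s≤s z≤n)) (length-filter (inClosedNbhd? (fzero , fsuc fzero)) D)

γ×-lower : ∀ r k B (D : List (Pair (4 + r))) → IsKTupleDominating (4 + r) k D →
  (∀ t s → t < B → t ≡ 2 * s ⊎ t ≡ 1 + 2 * s → ¬ DegreeCase r k t s) → k + B ≤ length D
γ×-lower r k B D isD@(vD , _ , dom) ¬case = split (B ≤? t)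
  where
  t = length D ∸ k
  |D|≡k+t : length D ≡ k + t
  |D|≡k+t = sym (m+[n∸m]≡n (k≤length D isD))
  split : Dec (B ≤ t) → k + B ≤ length D
  split (yes B≤t) = subst (k + B ≤_) (sym |D|≡k+t) (+-monoʳ-≤ k B≤t)
  split (no B≰t) with parity t
  ... | s , par = ⊥-elim (¬case t s (≰⇒> B≰t) par (degreeCase D vD dom |D|≡k+t s par))

-- Graphs on ℕ: circulants, matchings and complete graphs

Edge : Set
Edge = ℕ × ℕ

_≟ₑ_ : DecidableEquality Edge
_≟ₑ_ = ≡-dec _≟ℕ_ _≟ℕ_

degℕ : ℕ → List Edge → ℕ
degℕ y = sumBy (λ u → 𝟙 (proj₁ u ≟ℕ y) + 𝟙 (proj₂ u ≟ℕ y))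

mult : Edge → List Edge → ℕ
mult q = sumBy (λ u → 𝟙 (u ≟ₑ q))

InRange : ℕ → ℕ → Edge → Set
InRange o n (a , b) = o ≤ a × a < b × b < o + n

hits : ℕ → ℕ → ℕ → ℕ
hits x L y = sumUpTo L (λ p → 𝟙 (x + p ≟ℕ y))

hits≤1 : ∀ x L y → hits x L y ≤ 1
hits≤1 x L y = sumUpTo-𝟙-injective L (x +_) y (λ i j _ _ → +-cancelˡ-≡ x i j)

hits-below : ∀ x L y → y < x → hits x L y ≡ 0
hits-below x L y y<x = sumUpTo-𝟙-≡0 L (x +_) y (λ p _ x+p≡y → <⇒≱ y<x (subst (x ≤_) x+p≡y (m≤m+n x p)))

hits-above : ∀ x L y → x + L ≤ y → hits x L y ≡ 0
hits-above x L y x+L≤y = sumUpTo-𝟙-≡0 L (x +_) y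
  (λ p p<L x+p≡y → <⇒≱ (+-monoʳ-< x p<L) (subst (x + L ≤_) (sym x+p≡y) x+L≤y))

translates : ℕ → ℕ → ℕ → List Edge
translates a b zero = []
translates a b (suc L) = (a + L , b + L) ∷ translates a b L

sumBy-translates : ∀ (f : Edge → ℕ) a b L → sumBy f (translates a b L) ≡ sumUpTo L (λ p → f (a + p , b + p))
sumBy-translates f a b zero = refl
sumBy-translates f a b (suc L) = cong (f (a + L , b + L) +_) (sumBy-translates f a b L)

length-translates : ∀ a b L → length (translates a b L) ≡ L
length-translates a b zero = refl
length-translates a b (suc L) = cong suc (length-translates a b L)

All-translates : ∀ {p} (P : Edge → Set p) a b L → (∀ q → q < L → P (a + q , b + q)) → All P (translates a b L)
All-translates P a b zero h = All.[]
All-translates P a b (suc L) h = h L ≤-refl All.∷ All-translates P a b L (λ q q<L → h q (m<n⇒m<1+n q<L))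

degℕ-translates : ∀ a b L y → degℕ y (translates a b L) ≡ hits a L y + hits b L y
degℕ-translates a b L y = trans (sumBy-translates _ a b L) (sumUpTo-+ L _ _)

degℕ-++ : ∀ y xs ys → degℕ y (xs ++ ys) ≡ degℕ y xs + degℕ y ys
degℕ-++ y = sumBy-++ _

mult-++ : ∀ q xs ys → mult q (xs ++ ys) ≡ mult q xs + mult q ys
mult-++ q = sumBy-++ _

-- the edges {x, x + j} (indices taken mod n) of the circulant graph on o, …, o + n − 1
layer : ℕ → ℕ → ℕ → List Edge
layer o n j = translates o (o + j) (n ∸ j) ++ translates o (o + (n ∸ j)) j

circulant : ℕ → ℕ → ℕ → List Edge
circulant o n zero = []
circulant o n (suc j) = layer o n (suc j) ++ circulant o n j

matching : ℕ → ℕ → List Edge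
matching o h = translates o (o + h) h

private
  j≤n∸j : ∀ n j → 2 * j ≤ n → j ≤ n ∸ j
  j≤n∸j n j 2j≤n = ≤-trans (≤-reflexive (sym (m+n∸n≡m j j)))
    (∸-monoˡ-≤ j (≤-trans (≤-reflexive (cong (j +_) (sym (+-identityʳ j)))) 2j≤n))

  hits+0≤1 : ∀ x L y → hits x L y + 0 ≤ 1
  hits+0≤1 x L y = ≤-trans (≤-reflexive (+-identityʳ _)) (hits≤1 x L y)

degℕ-layer : ∀ o n j y → 2 * j ≤ n → degℕ y (layer o n j) ≤ 2
degℕ-layer o n j y 2j≤n
  rewrite degℕ-++ y (translates o (o + j) (n ∸ j)) (translates o (o + (n ∸ j)) j)
        | degℕ-translates o (o + j) (n ∸ j) y | degℕ-translates o (o + (n ∸ j)) j y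
  with y <? o + j | y <? o + (n ∸ j)
... | yes y<o+j | _
  rewrite hits-below (o + j) (n ∸ j) y y<o+j
        | hits-below (o + (n ∸ j)) j y (<-≤-trans y<o+j (+-monoʳ-≤ o (j≤n∸j n j 2j≤n)))
  = +-mono-≤ (hits+0≤1 o (n ∸ j) y) (hits+0≤1 o j y)
... | no y≮o+j | yes y<o+[n∸j]
  rewrite hits-above o j y (≮⇒≥ y≮o+j) | hits-below (o + (n ∸ j)) j y y<o+[n∸j]
  = ≤-trans (≤-reflexive (+-identityʳ _)) (+-mono-≤ (hits≤1 o (n ∸ j) y) (hits≤1 (o + j) (n ∸ j) y))
... | _ | no y≮o+[n∸j]
  rewrite hits-above o (n ∸ j) y (≮⇒≥ y≮o+[n∸j])
        | hits-above o j y (≤-trans (+-monoʳ-≤ o (j≤n∸j n j 2j≤n)) (≮⇒≥ y≮o+[n∸j]))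
  = +-mono-≤ (hits≤1 (o + j) (n ∸ j) y) (hits≤1 (o + (n ∸ j)) j y)

degℕ-circulant : ∀ o n w y → 2 * w ≤ n → degℕ y (circulant o n w) ≤ 2 * w
degℕ-circulant o n zero y _ = z≤n
degℕ-circulant o n (suc j) y 2[1+j]≤n = begin
  degℕ y (layer o n (suc j) ++ circulant o n j)         ≡⟨ degℕ-++ y (layer o n (suc j)) (circulant o n j) ⟩
  degℕ y (layer o n (suc j)) + degℕ y (circulant o n j) ≤⟨ +-mono-≤ (degℕ-layer o n (suc j) y 2[1+j]≤n)
                                                             (degℕ-circulant o n j y (≤-trans (*-monoʳ-≤ 2 (n≤1+n j)) 2[1+j]≤n)) ⟩
  2 + 2 * j                                             ≡⟨ *-suc 2 j ⟨
  2 * suc j                                             ∎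
  where open ≤-Reasoning

degℕ-matching : ∀ o h y → degℕ y (matching o h) ≤ 1
degℕ-matching o h y rewrite degℕ-translates o (o + h) h y with y <? o + h
... | yes y<o+h rewrite hits-below (o + h) h y y<o+h = hits+0≤1 o h y
... | no y≮o+h rewrite hits-above o h y (≮⇒≥ y≮o+h) = hits≤1 (o + h) h y

InRange-translates : ∀ o n δ L → 1 ≤ δ → δ + L ≤ n → All (InRange o n) (translates o (o + δ) L)
InRange-translates o n δ L 1≤δ δ+L≤n = All-translates (InRange o n) o (o + δ) L (λ q q<L →
  m≤m+n o q ,
  subst (o + q <_) (sym (+-assoc o δ q)) (+-monoʳ-< o (+-monoˡ-≤ q 1≤δ)) ,
  subst (_< o + n) (sym (+-assoc o δ q)) (+-monoʳ-< o (<-≤-trans (+-monoʳ-< δ q<L) δ+L≤n)))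

InRange-layer : ∀ o n j → 1 ≤ j → j < n → All (InRange o n) (layer o n j)
InRange-layer o n j 1≤j j<n = ++⁺
  (InRange-translates o n j (n ∸ j) 1≤j (≤-reflexive (m+[n∸m]≡n (<⇒≤ j<n))))
  (InRange-translates o n (n ∸ j) j (m<n⇒0<n∸m j<n) (≤-reflexive (m∸n+n≡m (<⇒≤ j<n))))

InRange-circulant : ∀ o n w → 2 * w < n → All (InRange o n) (circulant o n w)
InRange-circulant o n zero _ = All.[]
InRange-circulant o n (suc j) 2[1+j]<n = ++⁺
  (InRange-layer o n (suc j) (s≤s z≤n) (≤-<-trans (m≤m+n (suc j) _) 2[1+j]<n))
  (InRange-circulant o n j (≤-<-trans (*-monoʳ-≤ 2 (n≤1+n j)) 2[1+j]<n))

InRange-matching : ∀ o n h → 1 ≤ h → 2 * h ≤ n → All (InRange o n) (matching o h)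
InRange-matching o n h 1≤h 2h≤n =
  InRange-translates o n h h 1≤h (≤-trans (≤-reflexive (cong (h +_) (sym (+-identityʳ h)))) 2h≤n)

length-layer : ∀ o n j → j ≤ n → length (layer o n j) ≡ n
length-layer o n j j≤n = trans (length-++ (translates o (o + j) (n ∸ j)))
  (trans (cong₂ _+_ (length-translates o (o + j) (n ∸ j)) (length-translates o (o + (n ∸ j)) j)) (m∸n+n≡m j≤n))

length-circulant : ∀ o n w → w ≤ n → length (circulant o n w) ≡ w * n
length-circulant o n zero _ = refl
length-circulant o n (suc j) 1+j≤n = trans (length-++ (layer o n (suc j)))
  (cong₂ _+_ (length-layer o n (suc j) 1+j≤n) (length-circulant o n j (≤-trans (n≤1+n j) 1+j≤n)))

private
  InRange⇒≢ : ∀ {o n a b y} → InRange o n (a , b) → y < o ⊎ o + n ≤ y → a ≢ y × b ≢ y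
  InRange⇒≢ (o≤a , a<b , _) (inj₁ y<o) =
    (λ { refl → <⇒≱ y<o o≤a }) , (λ { refl → <⇒≱ y<o (<⇒≤ (≤-<-trans o≤a a<b)) })
  InRange⇒≢ (_ , a<b , b<o+n) (inj₂ o+n≤y) =
    (λ { refl → <⇒≱ (<-trans a<b b<o+n) o+n≤y }) , (λ { refl → <⇒≱ b<o+n o+n≤y })

degℕ-outside : ∀ o n (L : List Edge) y → All (InRange o n) L → y < o ⊎ o + n ≤ y → degℕ y L ≡ 0
degℕ-outside o n [] y _ _ = refl
degℕ-outside o n ((a , b) ∷ L) y (inR All.∷ inRs) out = cong₂ _+_
  (cong₂ _+_ (𝟙-no (a ≟ℕ y) (proj₁ (InRange⇒≢ inR out))) (𝟙-no (b ≟ℕ y) (proj₂ (InRange⇒≢ inR out))))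
  (degℕ-outside o n L y inRs out)

mult-outside : ∀ o n (L : List Edge) q1 q2 → All (InRange o n) L → q1 < o ⊎ o + n ≤ q1 → mult (q1 , q2) L ≡ 0
mult-outside o n [] q1 q2 _ _ = refl
mult-outside o n ((a , b) ∷ L) q1 q2 (inR All.∷ inRs) out = cong₂ _+_
  (𝟙-no ((a , b) ≟ₑ (q1 , q2)) (proj₁ (InRange⇒≢ inR out) ∘ cong proj₁))
  (mult-outside o n L q1 q2 inRs out)

mult-translates : ∀ a δ L q1 q2 → mult (q1 , q2) (translates a (a + δ) L) ≤ 𝟙 (q1 + δ ≟ℕ q2)
mult-translates a δ L q1 q2 rewrite sumBy-translates (λ u → 𝟙 (u ≟ₑ (q1 , q2))) a (a + δ) L with q1 + δ ≟ℕ q2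
... | yes _ = ≤-trans (sumUpTo-mono L _ _ (λ p _ → 𝟙-mono ((a + p , a + δ + p) ≟ₑ (q1 , q2)) (a + p ≟ℕ q1) (cong proj₁)))
                      (hits≤1 a L q1)
... | no q1+δ≢q2 = ≤-reflexive (sumUpTo-≡0 L _ (λ p _ → 𝟙-no ((a + p , a + δ + p) ≟ₑ (q1 , q2))
        (λ eq → q1+δ≢q2 (trans (cong (_+ δ) (sym (cong proj₁ eq))) (trans (+-assoc-comm a p δ) (cong proj₂ eq))))))
  where
  +-assoc-comm : ∀ a p δ → a + p + δ ≡ a + δ + p
  +-assoc-comm a p δ = solve (a ∷ p ∷ δ ∷ [])

offsets : ℕ → ℕ → ℕ → ℕ → ℕ
offsets n w q1 q2 = sumUpTo w (λ i → 𝟙 (q1 + suc i ≟ℕ q2) + 𝟙 (q1 + (n ∸ suc i) ≟ℕ q2))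

mult-layer : ∀ o n j q1 q2 → mult (q1 , q2) (layer o n j) ≤ 𝟙 (q1 + j ≟ℕ q2) + 𝟙 (q1 + (n ∸ j) ≟ℕ q2)
mult-layer o n j q1 q2 = ≤-trans (≤-reflexive (mult-++ (q1 , q2) (translates o (o + j) (n ∸ j)) _))
  (+-mono-≤ (mult-translates o j (n ∸ j) q1 q2) (mult-translates o (n ∸ j) j q1 q2))

mult-circulant : ∀ o n w q1 q2 → mult (q1 , q2) (circulant o n w) ≤ offsets n w q1 q2
mult-circulant o n zero q1 q2 = z≤n
mult-circulant o n (suc j) q1 q2 = ≤-trans (≤-reflexive (mult-++ (q1 , q2) (layer o n (suc j)) _))
  (+-mono-≤ (mult-layer o n (suc j) q1 q2) (mult-circulant o n j q1 q2))

private
  ≤n∸w : ∀ n w i → i < w → n ∸ w ≤ n ∸ suc i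
  ≤n∸w n w i i<w = ∸-monoʳ-≤ n i<w

  <∸ : ∀ {a δ n} → a + δ < n → a < n ∸ δ
  <∸ {a} {δ} a+δ<n = ≤-trans (≤-reflexive (sym (m+n∸n≡m (suc a) δ))) (∸-monoˡ-≤ δ a+δ<n)

  w<n∸w : ∀ n w → 2 * w < n → w < n ∸ w
  w<n∸w n w 2w<n = ≤-trans (≤-reflexive (sym (m+n∸n≡m (suc w) w)))
    (∸-monoˡ-≤ w (≤-trans (≤-reflexive (cong suc (cong (w +_) (sym (+-identityʳ w))))) 2w<n))

offsets≤1 : ∀ n w q1 q2 → 2 * w < n → offsets n w q1 q2 ≤ 1
offsets≤1 n w q1 q2 2w<n rewrite sumUpTo-+ w (λ i → 𝟙 (q1 + suc i ≟ℕ q2)) (λ i → 𝟙 (q1 + (n ∸ suc i) ≟ℕ q2))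
  with q2 ≤? q1 + w
... | yes q2≤q1+w rewrite sumUpTo-𝟙-≡0 w (λ i → q1 + (n ∸ suc i)) q2
        (λ i i<w eq → <⇒≱ (<-≤-trans (≤-<-trans q2≤q1+w (+-monoʳ-< q1 (w<n∸w n w 2w<n)))
                                      (+-monoʳ-≤ q1 (≤n∸w n w i i<w))) (≤-reflexive eq))
  = ≤-trans (≤-reflexive (+-identityʳ _))
      (sumUpTo-𝟙-injective w (λ i → q1 + suc i) q2 (λ i j _ _ eq → suc-injective (+-cancelˡ-≡ q1 _ _ eq)))
... | no q2≰q1+w rewrite sumUpTo-𝟙-≡0 w (λ i → q1 + suc i) q2
        (λ i i<w eq → <⇒≱ (≰⇒> q2≰q1+w) (≤-trans (≤-reflexive (sym eq)) (+-monoʳ-≤ q1 i<w)))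
  = sumUpTo-𝟙-injective w (λ i → q1 + (n ∸ suc i)) q2 (λ i j i<w j<w eq →
      suc-injective (∸-injective (≤-trans i<w w≤n) (≤-trans j<w w≤n) (+-cancelˡ-≡ q1 _ _ eq)))
  where
  w≤n : w ≤ n
  w≤n = <⇒≤ (≤-<-trans (m≤m+n w (w + 0)) 2w<n)
  ∸-injective : ∀ {a b} → a ≤ n → b ≤ n → n ∸ a ≡ n ∸ b → a ≡ b
  ∸-injective a≤n b≤n eq = trans (sym (m∸[m∸n]≡n a≤n)) (trans (cong (n ∸_) eq) (m∸[m∸n]≡n b≤n))

offsets≡0 : ∀ n w q1 h → w < h → h < n ∸ w → offsets n w q1 (q1 + h) ≡ 0
offsets≡0 n w q1 h w<h h<n∸w = sumUpTo-≡0 w _ (λ i i<w → cong₂ _+_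
  (𝟙-no (q1 + suc i ≟ℕ q1 + h) (λ eq → <⇒≢ (≤-<-trans i<w w<h) (+-cancelˡ-≡ q1 _ _ eq)))
  (𝟙-no (q1 + (n ∸ suc i) ≟ℕ q1 + h) (λ eq → <⇒≢ (<-≤-trans h<n∸w (≤n∸w n w i i<w)) (sym (+-cancelˡ-≡ q1 _ _ eq)))))

mult-circulant≤1 : ∀ o n w q → 2 * w < n → mult q (circulant o n w) ≤ 1
mult-circulant≤1 o n w (q1 , q2) 2w<n = ≤-trans (mult-circulant o n w q1 q2) (offsets≤1 n w q1 q2 2w<n)

mult-circulant+matching≤1 : ∀ o n w h q → 2 * w < n → w < h → h < n ∸ w →
  mult q (circulant o n w ++ matching o h) ≤ 1
mult-circulant+matching≤1 o n w h (q1 , q2) 2w<n w<h h<n∸w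
  rewrite mult-++ (q1 , q2) (circulant o n w) (matching o h) with q1 + h ≟ℕ q2
... | yes refl = +-mono-≤ (≤-trans (mult-circulant o n w q1 (q1 + h)) (≤-reflexive (offsets≡0 n w q1 h w<h h<n∸w)))
                          (≤-trans (mult-translates o h h q1 (q1 + h)) (𝟙≤1 (q1 + h ≟ℕ q1 + h)))
... | no q1+h≢q2 = ≤-trans (+-mono-≤ (mult-circulant≤1 o n w (q1 , q2) 2w<n)
                                    (≤-trans (mult-translates o h h q1 q2) (≤-reflexive (𝟙-no (q1 + h ≟ℕ q2) q1+h≢q2))))
                           (≤-reflexive (+-identityʳ 1))

mult-translates≥1 : ∀ a b L p → p < L → 1 ≤ mult (a + p , b + p) (translates a b L)
mult-translates≥1 a b L p p<L rewrite sumBy-translates (λ u → 𝟙 (u ≟ₑ (a + p , b + p))) a b L =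
  ≤-trans (≤-reflexive (sym (𝟙-yes ((a + p , b + p) ≟ₑ (a + p , b + p)) refl))) (term≤sumUpTo L _ p p<L)

mult-layer≤mult-circulant : ∀ o n w j q → 1 ≤ j → j ≤ w → mult q (layer o n j) ≤ mult q (circulant o n w)
mult-layer≤mult-circulant o n zero j q 1≤j j≤0 = ⊥-elim (<⇒≱ 1≤j j≤0)
mult-layer≤mult-circulant o n (suc i) j q 1≤j j≤1+i rewrite mult-++ q (layer o n (suc i)) (circulant o n i)
  with j ≟ℕ suc i
... | yes refl = m≤m+n _ _
... | no j≢1+i = ≤-trans (mult-layer≤mult-circulant o n i j q 1≤j (≤-pred (≤∧≢⇒< j≤1+i j≢1+i))) (m≤n+m _ _)

layer∋short : ∀ n δ a → a + δ < n → 1 ≤ mult (a , δ + a) (layer 0 n δ)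
layer∋short n δ a a+δ<n = ≤-trans (mult-translates≥1 0 δ (n ∸ δ) a (<∸ a+δ<n))
  (≤-trans (m≤m+n _ _) (≤-reflexive (sym (mult-++ (a , δ + a) (translates 0 δ (n ∸ δ)) _))))

layer∋long : ∀ n j a → a < j → 1 ≤ mult (a , (n ∸ j) + a) (layer 0 n j)
layer∋long n j a a<j = ≤-trans (mult-translates≥1 0 (n ∸ j) j a a<j)
  (≤-trans (m≤n+m _ _) (≤-reflexive (sym (mult-++ (a , (n ∸ j) + a) (translates 0 j (n ∸ j)) _))))

circulant-∋ : ∀ n w a δ → 1 ≤ δ → a + δ < n → (δ ≤ w ⊎ n ≤ w + δ) → 1 ≤ mult (a , δ + a) (circulant 0 n w)
circulant-∋ n w a δ 1≤δ a+δ<n (inj₁ δ≤w) =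
  ≤-trans (layer∋short n δ a a+δ<n) (mult-layer≤mult-circulant 0 n w δ (a , δ + a) 1≤δ δ≤w)
circulant-∋ n w a δ 1≤δ a+δ<n (inj₂ n≤w+δ) =
  ≤-trans (subst (λ z → 1 ≤ mult (a , z + a) (layer 0 n j)) n∸j≡δ (layer∋long n j a (<∸ a+δ<n)))
          (mult-layer≤mult-circulant 0 n w j (a , δ + a) (m<n⇒0<n∸m δ<n)
            (m≤n+o⇒m∸n≤o n δ (≤-trans n≤w+δ (≤-reflexive (+-comm w δ)))))
  where
  j = n ∸ δ
  δ<n : δ < n
  δ<n = ≤-<-trans (m≤n+m δ a) a+δ<n
  n∸j≡δ : n ∸ j ≡ δ
  n∸j≡δ = m∸[m∸n]≡n (<⇒≤ δ<n)

private
  gap : ∀ {a b} → a < b → 1 ≤ b ∸ a × b ∸ a + a ≡ b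
  gap a<b = m<n⇒0<n∸m a<b , m∸n+n≡m (<⇒≤ a<b)

  a+gap<n : ∀ {a b n} → a < b → b < n → a + (b ∸ a) < n
  a+gap<n {a} a<b b<n = subst (_< _) (sym (m+[n∸m]≡n (<⇒≤ a<b))) b<n

circulant-complete : ∀ w a b → a < b → b < suc (2 * w) → 1 ≤ mult (a , b) (circulant 0 (suc (2 * w)) w)
circulant-complete w a b a<b b<n = subst (λ z → 1 ≤ mult (a , z) (circulant 0 (suc (2 * w)) w)) (proj₂ (gap a<b))
  (circulant-∋ (suc (2 * w)) w a δ (proj₁ (gap a<b)) (a+gap<n a<b b<n) short-or-long)
  where
  δ = b ∸ a
  short-or-long : δ ≤ w ⊎ suc (2 * w) ≤ w + δ
  short-or-long with δ ≤? w
  ... | yes δ≤w = inj₁ δ≤w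
  ... | no δ≰w = inj₂ (begin
    suc (2 * w) ≡⟨ solve (w ∷ []) ⟩
    w + suc w   ≤⟨ +-monoʳ-≤ w (≰⇒> δ≰w) ⟩
    w + δ       ∎)
    where open ≤-Reasoning

circulant+matching-complete : ∀ w a b → a < b → b < 2 + 2 * w →
  1 ≤ mult (a , b) (circulant 0 (2 + 2 * w) w ++ matching 0 (suc w))
circulant+matching-complete w a b a<b b<n =
  subst (λ z → 1 ≤ mult (a , z) (circulant 0 (2 + 2 * w) w ++ matching 0 (suc w))) (proj₂ (gap a<b))
  (∋ (b ∸ a) (proj₁ (gap a<b)) (a+gap<n a<b b<n))
  where
  open ≤-Reasoning
  ∋ : ∀ δ → 1 ≤ δ → a + δ < 2 + 2 * w → 1 ≤ mult (a , δ + a) (circulant 0 (2 + 2 * w) w ++ matching 0 (suc w))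
  ∋ δ 1≤δ a+δ<n rewrite mult-++ (a , δ + a) (circulant 0 (2 + 2 * w) w) (matching 0 (suc w)) with δ ≤? w | δ ≟ℕ suc w
  ... | yes δ≤w | _ = ≤-trans (circulant-∋ (2 + 2 * w) w a δ 1≤δ a+δ<n (inj₁ δ≤w)) (m≤m+n _ _)
  ... | no _ | yes refl = ≤-trans (mult-translates≥1 0 (suc w) (suc w) a (+-cancelʳ-< (suc w) a (suc w) (begin-strict
    a + suc w     <⟨ a+δ<n ⟩
    2 + 2 * w     ≡⟨ solve (w ∷ []) ⟩
    suc w + suc w ∎))) (m≤n+m _ (mult (a , suc w + a) (circulant 0 (2 + 2 * w) w)))
  ... | no δ≰w | no δ≢1+w = ≤-trans (circulant-∋ (2 + 2 * w) w a δ 1≤δ a+δ<n (inj₂ (begin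
    2 + 2 * w       ≡⟨ solve (w ∷ []) ⟩
    w + suc (suc w) ≤⟨ +-monoʳ-≤ w (≤∧≢⇒< (≰⇒> δ≰w) (δ≢1+w ∘ sym)) ⟩
    w + δ           ∎))) (m≤m+n _ _)

-- From graphs to k-tuple dominating sets

-- clamps to the last element, so it is a section of toℕ only on 0, …, n
toFin : ∀ n → ℕ → Fin (suc n)
toFin n zero = fzero
toFin zero (suc a) = fzero
toFin (suc n) (suc a) = fsuc (toFin n a)

toℕ-toFin : ∀ n a → a ≤ n → toℕ (toFin n a) ≡ a
toℕ-toFin n zero _ = refl
toℕ-toFin (suc n) (suc a) (s≤s a≤n) = cong suc (toℕ-toFin n a a≤n)

toFin-toℕ : ∀ n (x : Fin (suc n)) → toFin n (toℕ x) ≡ x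
toFin-toℕ n fzero = refl
toFin-toℕ (suc n) (fsuc x) = cong fsuc (toFin-toℕ n x)

module _ (n : ℕ) where

  toPair : Edge → Pair (suc n)
  toPair (a , b) = (toFin n a , toFin n b)

  private
    _≟ᵖ_ : DecidableEquality (Pair (suc n))
    _≟ᵖ_ = ≡-dec _≟ᶠ_ _≟ᶠ_

    module _ {a b : ℕ} (a<b<n : InRange 0 (suc n) (a , b)) where
      a≤n : a ≤ n
      a≤n = ≤-pred (<-trans (proj₁ (proj₂ a<b<n)) (proj₂ (proj₂ a<b<n)))

      b≤n : b ≤ n
      b≤n = ≤-pred (proj₂ (proj₂ a<b<n))

      toPair-vertex : IsVertex (toPair (a , b))
      toPair-vertex = subst₂ _<_ (sym (toℕ-toFin n a a≤n)) (sym (toℕ-toFin n b b≤n)) (proj₁ (proj₂ a<b<n))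

      𝟙-∈-toPair : ∀ y → 𝟙 (y ∈ₚ? toPair (a , b)) ≤ 𝟙 (a ≟ℕ toℕ y) + 𝟙 (b ≟ℕ toℕ y)
      𝟙-∈-toPair y = ≤-trans (𝟙-⊎-≤ (toFin n a ≟ᶠ y) (toFin n b ≟ᶠ y))
        (+-mono-≤ (𝟙-mono (toFin n a ≟ᶠ y) (a ≟ℕ toℕ y) (λ eq → trans (sym (toℕ-toFin n a a≤n)) (cong toℕ eq)))
                  (𝟙-mono (toFin n b ≟ᶠ y) (b ≟ℕ toℕ y) (λ eq → trans (sym (toℕ-toFin n b b≤n)) (cong toℕ eq))))

      𝟙-≟-toPair : ∀ x y → 𝟙 ((a , b) ≟ₑ (toℕ x , toℕ y)) ≤ 𝟙 (x ∈ₚ? toPair (a , b)) * 𝟙 (y ∈ₚ? toPair (a , b))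
      𝟙-≟-toPair x y with (a , b) ≟ₑ (toℕ x , toℕ y)
      ... | no _ = z≤n
      ... | yes eq rewrite 𝟙-yes (x ∈ₚ? toPair (a , b)) (inj₁ (trans (cong (toFin n) (cong proj₁ eq)) (toFin-toℕ n x)))
                         | 𝟙-yes (y ∈ₚ? toPair (a , b)) (inj₂ (trans (cong (toFin n) (cong proj₂ eq)) (toFin-toℕ n y))) = ≤-refl

      𝟙-toPair-≟ : ∀ v → 𝟙 (toPair (a , b) ≟ᵖ v) ≤ 𝟙 ((a , b) ≟ₑ (toℕ (proj₁ v) , toℕ (proj₂ v)))
      𝟙-toPair-≟ (v₁ , v₂) = 𝟙-mono (toPair (a , b) ≟ᵖ (v₁ , v₂)) ((a , b) ≟ₑ (toℕ v₁ , toℕ v₂)) (λ eq →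
        cong₂ _,_ (trans (sym (toℕ-toFin n a a≤n)) (cong (toℕ ∘ proj₁) eq))
                  (trans (sym (toℕ-toFin n b b≤n)) (cong (toℕ ∘ proj₂) eq)))

  graph⇒dominating : ∀ k (L : List Edge) → All (InRange 0 (suc n)) L → (∀ q → mult q L ≤ 1) →
    (∀ a b → a < b → b < suc n → k + degℕ a L + degℕ b L ≤ length L + 2 * mult (a , b) L) →
    IsKTupleDominating (suc n) k (map toPair L)
  graph⇒dominating k L inR simple criterion = vD , uD , dom
    where
    D = map toPair L
    onL : ∀ {P : Edge → Set} → (∀ {a b} → InRange 0 (suc n) (a , b) → P (a , b)) → All P L
    onL h = All.map (λ {u} → h {proj₁ u} {proj₂ u}) inR
    vD : All IsVertex D
    vD = map⁺ (onL toPair-vertex)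
    uD : Unique D
    uD = count≤1⇒Unique _≟ᵖ_ D (λ v → begin
      sumBy (λ w → 𝟙 (w ≟ᵖ v)) (map toPair L)  ≡⟨ sumBy-map _ toPair L ⟩
      sumBy (λ u → 𝟙 (toPair u ≟ᵖ v)) L        ≤⟨ sumBy-mono (onL (λ inR → 𝟙-toPair-≟ inR v)) ⟩
      mult (toℕ (proj₁ v) , toℕ (proj₂ v)) L    ≤⟨ simple _ ⟩
      1                                         ∎)
      where open ≤-Reasoning
    deg≤degℕ : ∀ y → deg y D ≤ degℕ (toℕ y) L
    deg≤degℕ y = ≤-trans (≤-reflexive (sumBy-map _ toPair L)) (sumBy-mono (onL (λ inR → 𝟙-∈-toPair inR y)))
    mult≤codeg : ∀ x y → mult (toℕ x , toℕ y) L ≤ codeg x y D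
    mult≤codeg x y = ≤-trans (sumBy-mono (onL (λ inR → 𝟙-≟-toPair inR x y))) (≤-reflexive (sym (sumBy-map _ toPair L)))
    dom : ∀ v → IsVertex v → k ≤ nbhdCount v D
    dom (x , y) x<y = +-cancelʳ-≤ (deg x D + deg y D) k (nbhdCount (x , y) D) (begin
      k + (deg x D + deg y D)                   ≡⟨ +-assoc k _ _ ⟨
      k + deg x D + deg y D                     ≤⟨ +-mono-≤ (+-monoʳ-≤ k (deg≤degℕ x)) (deg≤degℕ y) ⟩
      k + degℕ (toℕ x) L + degℕ (toℕ y) L       ≤⟨ criterion (toℕ x) (toℕ y) x<y (toℕ<n y) ⟩
      length L + 2 * mult (toℕ x , toℕ y) L     ≤⟨ +-mono-≤ (≤-reflexive (sym (length-map toPair L))) (*-monoʳ-≤ 2 (mult≤codeg x y)) ⟩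
      length D + 2 * codeg x y D                ≡⟨ nbhdCount+deg+deg≡length+2*codeg x y x<y D vD ⟨
      nbhdCount (x , y) D + deg x D + deg y D   ≡⟨ +-assoc (nbhdCount (x , y) D) _ _ ⟩
      nbhdCount (x , y) D + (deg x D + deg y D) ∎)
      where open ≤-Reasoning

  prefix⇒dominating : ∀ k M (L : List Edge) → All (InRange 0 (suc n)) L → (∀ q → mult q L ≤ 1) → M ≤ length L →
    (∀ a b → a < b → b < suc n → k + degℕ a L + degℕ b L ≤ M + 2 * mult (a , b) (take M L)) →
    ∃ λ D → IsKTupleDominating (suc n) k D × length D ≡ M
  prefix⇒dominating k M L inR simple M≤|L| criterion =
    map toPair (take M L) ,
    graph⇒dominating k (take M L) (take⁺ M inR) (λ q → ≤-trans (sumBy-take _ M L) (simple q)) criterion′ ,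
    trans (length-map toPair (take M L)) |take|
    where
    |take| : length (take M L) ≡ M
    |take| = trans (length-take M L) (m≤n⇒m⊓n≡m M≤|L|)
    criterion′ : ∀ a b → a < b → b < suc n →
      k + degℕ a (take M L) + degℕ b (take M L) ≤ length (take M L) + 2 * mult (a , b) (take M L)
    criterion′ a b a<b b<n = ≤-trans (+-mono-≤ (+-monoʳ-≤ k (sumBy-take _ M L)) (sumBy-take _ M L))
      (subst (λ m → _ ≤ m + 2 * mult (a , b) (take M L)) (sym |take|) (criterion a b a<b b<n))

record Graph (o N Δ : ℕ) : Set where
  field
    edges   : List Edge
    inRange : All (InRange o N) edges
    simple  : ∀ q → mult q edges ≤ 1
    maxDeg  : ∀ y → degℕ y edges ≤ Δ

open Graph

private
  half-bounds : ∀ N → 2 * (N / 2) ≤ N × N ≤ 2 * (N / 2) + 1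
  half-bounds N = ≤-trans (≤-reflexive (*-comm 2 (N / 2))) (m/n*n≤m N 2) , (begin
    N                 ≡⟨ m≡m%n+[m/n]*n N 2 ⟩
    N % 2 + N / 2 * 2 ≤⟨ +-monoˡ-≤ (N / 2 * 2) (≤-pred (m%n<n N 2)) ⟩
    1 + N / 2 * 2     ≡⟨ trans (+-comm 1 (N / 2 * 2)) (cong (_+ 1) (*-comm (N / 2) 2)) ⟩
    2 * (N / 2) + 1   ∎)
    where open ≤-Reasoning

  halve : ∀ M X → 2 * M ≤ 2 * X + 1 → M ≤ X
  halve M X 2M≤2X+1 = ≤-pred (*-cancelˡ-< 2 M (suc X) (begin-strict
    2 * M         ≤⟨ 2M≤2X+1 ⟩
    2 * X + 1     <⟨ n<1+n _ ⟩
    suc (2 * X + 1) ≡⟨ solve (X ∷ []) ⟩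
    2 * suc X     ∎))
    where open ≤-Reasoning

boundedDegreeGraph : ∀ o N α → α < N → Σ (Graph o N α) λ G → ∀ M → 2 * M ≤ α * N → M ≤ length (edges G)
boundedDegreeGraph o N α α<N with parity α
... | w , inj₁ refl = G , capacity
  where
  2w<N : 2 * w < N
  2w<N = α<N
  G : Graph o N (2 * w)
  G = record { edges = circulant o N w ; inRange = InRange-circulant o N w 2w<N
             ; simple = λ q → mult-circulant≤1 o N w q 2w<N ; maxDeg = λ y → degℕ-circulant o N w y (<⇒≤ 2w<N) }
  capacity : ∀ M → 2 * M ≤ 2 * w * N → M ≤ length (circulant o N w)
  capacity M 2M≤ = *-cancelˡ-≤ 2 (begin
    2 * M                           ≤⟨ 2M≤ ⟩
    2 * w * N                       ≡⟨ *-assoc 2 w N ⟩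
    2 * (w * N)                     ≡⟨ cong (2 *_) (length-circulant o N w (≤-trans (m≤m+n w (w + 0)) (<⇒≤ 2w<N))) ⟨
    2 * length (circulant o N w)    ∎)
    where open ≤-Reasoning
... | w , inj₂ refl = G , capacity
  where
  open ≤-Reasoning
  h = N / 2
  2h≤N : 2 * h ≤ N
  2h≤N = proj₁ (half-bounds N)
  N≤2h+1 : N ≤ 2 * h + 1
  N≤2h+1 = proj₂ (half-bounds N)
  2w<N : 2 * w < N
  2w<N = <-trans (n<1+n (2 * w)) α<N
  w<h : w < h
  w<h = halve (suc w) h (begin
    2 * suc w     ≡⟨ solve (w ∷ []) ⟩
    suc (suc (2 * w)) ≤⟨ α<N ⟩
    N             ≤⟨ N≤2h+1 ⟩
    2 * h + 1     ∎)
  h<N∸w : h < N ∸ w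
  h<N∸w = <∸ (begin-strict
    h + w           <⟨ +-monoʳ-< h w<h ⟩
    h + h           ≡⟨ cong (h +_) (+-identityʳ h) ⟨
    2 * h           ≤⟨ 2h≤N ⟩
    N               ∎)
  L = circulant o N w ++ matching o h
  G : Graph o N (1 + 2 * w)
  G = record
    { edges = L
    ; inRange = ++⁺ (InRange-circulant o N w 2w<N) (InRange-matching o N h (≤-trans (s≤s z≤n) w<h) 2h≤N)
    ; simple = λ q → mult-circulant+matching≤1 o N w h q 2w<N w<h h<N∸w
    ; maxDeg = λ y → begin
        degℕ y L                                         ≡⟨ degℕ-++ y (circulant o N w) (matching o h) ⟩
        degℕ y (circulant o N w) + degℕ y (matching o h) ≤⟨ +-mono-≤ (degℕ-circulant o N w y (<⇒≤ 2w<N)) (degℕ-matching o h y) ⟩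
        2 * w + 1                                        ≡⟨ +-comm (2 * w) 1 ⟩
        1 + 2 * w                                        ∎
    }
  capacity : ∀ M → 2 * M ≤ (1 + 2 * w) * N → M ≤ length L
  capacity M 2M≤ = subst (M ≤_) |L| (halve M (w * N + h) (begin
    2 * M                    ≤⟨ 2M≤ ⟩
    (1 + 2 * w) * N          ≡⟨ solve (w ∷ N ∷ []) ⟩
    2 * (w * N) + N          ≤⟨ +-monoʳ-≤ (2 * (w * N)) N≤2h+1 ⟩
    2 * (w * N) + (2 * h + 1) ≡⟨ trans (sym (+-assoc (2 * (w * N)) (2 * h) 1)) (cong (_+ 1) (sym (*-distribˡ-+ 2 (w * N) h))) ⟩
    2 * (w * N + h) + 1      ∎))
    where
    |L| : w * N + h ≡ length L
    |L| = sym (trans (length-++ (circulant o N w))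
      (cong₂ _+_ (length-circulant o N w (≤-trans (m≤m+n w (w + 0)) (<⇒≤ 2w<N))) (length-translates o (o + h) h)))

completeGraph : ∀ m → Σ (Graph 0 (suc m) m) λ G →
  (∀ a b → a < b → b < suc m → 1 ≤ mult (a , b) (edges G)) × 2 * length (edges G) ≡ suc m * m
completeGraph m with parity m
... | w , inj₁ refl = G , circulant-complete w , (begin
    2 * length (circulant 0 (suc (2 * w)) w)
      ≡⟨ cong (2 *_) (length-circulant 0 (suc (2 * w)) w (≤-trans (m≤m+n w (w + 0)) (n≤1+n _))) ⟩
    2 * (w * suc (2 * w))                    ≡⟨ solve (w ∷ []) ⟩
    suc (2 * w) * (2 * w)                    ∎)
  where
  open ≡-Reasoning
  G : Graph 0 (suc (2 * w)) (2 * w)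
  G = record { edges = circulant 0 (suc (2 * w)) w ; inRange = InRange-circulant 0 (suc (2 * w)) w ≤-refl
             ; simple = λ q → mult-circulant≤1 0 (suc (2 * w)) w q ≤-refl
             ; maxDeg = λ y → degℕ-circulant 0 (suc (2 * w)) w y (n≤1+n _) }
... | w , inj₂ refl = G , circulant+matching-complete w , (begin
    2 * length K                               ≡⟨ cong (2 *_) (length-++ (circulant 0 (2 + 2 * w) w)) ⟩
    2 * (length (circulant 0 (2 + 2 * w) w) + length (matching 0 (suc w)))
      ≡⟨ cong₂ (λ x y → 2 * (x + y)) (length-circulant 0 (2 + 2 * w) w (≤-trans (m≤m+n w (w + 0)) (≤-trans (n≤1+n _) (n≤1+n _))))
                                     (length-translates 0 (suc w) (suc w)) ⟩
    2 * (w * (2 + 2 * w) + suc w)              ≡⟨ solve (w ∷ []) ⟩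
    (2 + 2 * w) * (1 + 2 * w)                  ∎)
  where
  K = circulant 0 (2 + 2 * w) w ++ matching 0 (suc w)
  open ≡-Reasoning
  2w<2+2w : 2 * w < 2 + 2 * w
  2w<2+2w = n≤1+n _
  1+w<[2+2w]∸w : suc w < (2 + 2 * w) ∸ w
  1+w<[2+2w]∸w = <∸ {suc w} {w} {2 + 2 * w} (≤-reflexive (solve (w ∷ [])))
  G : Graph 0 (2 + 2 * w) (1 + 2 * w)
  G = record
    { edges = K
    ; inRange = ++⁺ (InRange-circulant 0 (2 + 2 * w) w 2w<2+2w)
                    (InRange-matching 0 (2 + 2 * w) (suc w) (s≤s z≤n) (≤-reflexive (solve (w ∷ []))))
    ; simple = λ q → mult-circulant+matching≤1 0 (2 + 2 * w) w (suc w) q 2w<2+2w (n<1+n w) 1+w<[2+2w]∸w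
    ; maxDeg = λ y → ≤-trans (≤-reflexive (degℕ-++ y (circulant 0 (2 + 2 * w) w) (matching 0 (suc w))))
        (≤-trans (+-mono-≤ (degℕ-circulant 0 (2 + 2 * w) w y (<⇒≤ 2w<2+2w)) (degℕ-matching 0 (suc w) y))
                 (≤-reflexive (+-comm (2 * w) 1)))
    }

-- The upper bounds

γ×-upper₁ : ∀ n α k → α < suc n → 2 * k + 4 * α ≤ α * suc n →
  ∃ λ D → IsKTupleDominating (suc n) k D × length D ≡ k + 2 * α
γ×-upper₁ n α k α<N 2k+4α≤αN = prefix⇒dominating n k (k + 2 * α) (edges G) (inRange G) (simple G) M≤|G| criterion
  where
  open ≤-Reasoning
  G : Graph 0 (suc n) α
  G = proj₁ (boundedDegreeGraph 0 (suc n) α α<N)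
  M≤|G| : k + 2 * α ≤ length (edges G)
  M≤|G| = proj₂ (boundedDegreeGraph 0 (suc n) α α<N) (k + 2 * α) (begin
    2 * (k + 2 * α) ≡⟨ solve (k ∷ α ∷ []) ⟩
    2 * k + 4 * α   ≤⟨ 2k+4α≤αN ⟩
    α * suc n       ∎)
  criterion : ∀ a b → a < b → b < suc n →
    k + degℕ a (edges G) + degℕ b (edges G) ≤ k + 2 * α + 2 * mult (a , b) (take (k + 2 * α) (edges G))
  criterion a b _ _ = begin
    k + degℕ a (edges G) + degℕ b (edges G) ≤⟨ +-mono-≤ (+-monoʳ-≤ k (maxDeg G a)) (maxDeg G b) ⟩
    k + α + α                               ≡⟨ solve (k ∷ α ∷ []) ⟩
    k + 2 * α                               ≤⟨ m≤m+n _ _ ⟩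
    k + 2 * α + 2 * mult (a , b) (take (k + 2 * α) (edges G)) ∎

private
  complete-part-fits : ∀ α k r → 2 * α ≤ 1 + r → α * r < 2 * k → (2 + α) * (1 + α) ≤ 2 * (k + 2 * α + 1)
  complete-part-fits α k r 2α≤1+r αr<2k = begin
    (2 + α) * (1 + α)    ≡⟨ solve (α ∷ []) ⟩
    α * α + 3 * α + 2    ≤⟨ +-monoˡ-≤ 2 (+-monoˡ-≤ (3 * α) (*-monoʳ-≤ α (≤-trans (m≤m+n α (α + 0)) 2α≤1+r))) ⟩
    α * (1 + r) + 3 * α + 2 ≡⟨ solve (α ∷ r ∷ []) ⟩
    α * r + 4 * α + 2    ≤⟨ +-monoˡ-≤ 2 (+-monoˡ-≤ (4 * α) (<⇒≤ αr<2k)) ⟩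
    2 * k + 4 * α + 2    ≡⟨ solve (k ∷ α ∷ []) ⟩
    2 * (k + 2 * α + 1)  ∎
    where open ≤-Reasoning

  both-parts-suffice : ∀ α k r n₂ → 2 + α + n₂ ≡ 4 + r → 2 * k ≤ α * (1 + r) →
    2 * (k + 2 * α + 1) ≤ (2 + α) * (1 + α) + α * n₂
  both-parts-suffice α k r n₂ c+n₂≡4+r 2k≤α[1+r] = begin
    2 * (k + 2 * α + 1)            ≡⟨ solve (k ∷ α ∷ []) ⟩
    2 * k + 4 * α + 2              ≤⟨ +-monoˡ-≤ 2 (+-monoˡ-≤ (4 * α) 2k≤α[1+r]) ⟩
    α * (1 + r) + 4 * α + 2        ≡⟨ solve (α ∷ r ∷ []) ⟩
    α * (4 + r) + α + 2            ≡⟨ cong (λ N → α * N + α + 2) c+n₂≡4+r ⟨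
    α * (2 + α + n₂) + α + 2       ≡⟨ solve (α ∷ n₂ ∷ []) ⟩
    (2 + α) * (1 + α) + α * n₂     ∎
    where open ≤-Reasoning

module _ {α c′ n₂ : ℕ} (K : Graph 0 (suc c′) (suc α)) (R : Graph (suc c′) n₂ α) where

  private
    c = suc c′
    L = edges K ++ edges R

  union-inRange : All (InRange 0 (c + n₂)) L
  union-inRange = ++⁺ (All.map (λ { {a , b} (_ , a<b , b<c) → z≤n , a<b , <-≤-trans b<c (m≤m+n c n₂) }) (inRange K))
                      (All.map (λ { {a , b} (_ , a<b , b<c+n₂) → z≤n , a<b , b<c+n₂ }) (inRange R))

  union-simple : ∀ q → mult q L ≤ 1
  union-simple (q₁ , q₂) with q₁ <? c
  ... | yes q₁<c = ≤-trans (≤-reflexive (trans (mult-++ (q₁ , q₂) (edges K) (edges R))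
          (trans (cong (mult (q₁ , q₂) (edges K) +_) (mult-outside c n₂ (edges R) q₁ q₂ (inRange R) (inj₁ q₁<c)))
                 (+-identityʳ _))))
          (simple K (q₁ , q₂))
  ... | no q₁≮c = ≤-trans (≤-reflexive (trans (mult-++ (q₁ , q₂) (edges K) (edges R))
          (cong (_+ mult (q₁ , q₂) (edges R)) (mult-outside 0 c (edges K) q₁ q₂ (inRange K) (inj₂ (≮⇒≥ q₁≮c))))))
          (simple R (q₁ , q₂))

  union-degℕ-right : ∀ y → c ≤ y → degℕ y L ≤ α
  union-degℕ-right y c≤y = ≤-trans (≤-reflexive (trans (degℕ-++ y (edges K) (edges R))
    (cong (_+ degℕ y (edges R)) (degℕ-outside 0 c (edges K) y (inRange K) (inj₂ c≤y)))))
    (maxDeg R y)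

  union-degℕ : ∀ y → degℕ y L ≤ suc α
  union-degℕ y with y <? c
  ... | yes y<c = ≤-trans (≤-reflexive (trans (degℕ-++ y (edges K) (edges R))
    (trans (cong (degℕ y (edges K) +_) (degℕ-outside c n₂ (edges R) y (inRange R) (inj₁ y<c))) (+-identityʳ _))))
    (maxDeg K y)
  ... | no y≮c = ≤-trans (union-degℕ-right y (≮⇒≥ y≮c)) (n≤1+n α)

  -- the points of K have degree α + 1, compensated by adjacency since all of K lies in the prefix
  complete+bounded⇒dominating : ∀ k → (∀ a b → a < b → b < c → 1 ≤ mult (a , b) (edges K)) →
    length (edges K) ≤ k + 2 * α + 1 → k + 2 * α + 1 ≤ length L →
    ∃ λ D → IsKTupleDominating (c + n₂) k D × length D ≡ k + 2 * α + 1
  complete+bounded⇒dominating k complete |K|≤M M≤|L| =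
    prefix⇒dominating (c′ + n₂) k M L union-inRange union-simple M≤|L| criterion
    where
    open ≤-Reasoning
    M = k + 2 * α + 1
    criterion : ∀ a b → a < b → b < c + n₂ → k + degℕ a L + degℕ b L ≤ M + 2 * mult (a , b) (take M L)
    criterion a b a<b _ with b <? c
    ... | yes b<c = begin
      k + degℕ a L + degℕ b L   ≤⟨ +-mono-≤ (+-monoʳ-≤ k (union-degℕ a)) (union-degℕ b) ⟩
      k + suc α + suc α         ≡⟨ solve (k ∷ α ∷ []) ⟩
      k + 2 * α + 1 + 1         ≤⟨ +-monoʳ-≤ M (≤-trans (s≤s z≤n) (*-monoʳ-≤ 2 (≤-trans (complete a b a<b b<c)
                                     (sumBy≤sumBy-take-++ _ M (edges K) (edges R) |K|≤M)))) ⟩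
      M + 2 * mult (a , b) (take M L) ∎
    ... | no b≮c = begin
      k + degℕ a L + degℕ b L   ≤⟨ +-mono-≤ (+-monoʳ-≤ k (union-degℕ a)) (union-degℕ-right b (≮⇒≥ b≮c)) ⟩
      k + suc α + α             ≡⟨ solve (k ∷ α ∷ []) ⟩
      k + 2 * α + 1             ≤⟨ m≤m+n M _ ⟩
      M + 2 * mult (a , b) (take M L) ∎

private
  γ×-upper₂′ : ∀ r α k n₂ → 2 + α + n₂ ≡ 4 + r → α < n₂ → 2 * α ≤ 1 + r →
    α * r < 2 * k → 2 * k ≤ α * (1 + r) →
    ∃ λ D → IsKTupleDominating (2 + α + n₂) k D × length D ≡ k + 2 * α + 1
  γ×-upper₂′ r α k n₂ c+n₂≡4+r α<n₂ 2α≤1+r αr<2k 2k≤α[1+r]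
    with completeGraph (suc α) | boundedDegreeGraph (2 + α) n₂ α α<n₂
  ... | K , complete , 2|K|≡ | R , capacity = complete+bounded⇒dominating K R k complete |K|≤M M≤|L|
    where
    open ≤-Reasoning
    M = k + 2 * α + 1
    |K| = length (edges K)
    |K|≤M : |K| ≤ M
    |K|≤M = *-cancelˡ-≤ 2 (≤-trans (≤-reflexive 2|K|≡) (complete-part-fits α k r 2α≤1+r αr<2k))
    M∸|K|≤|R| : M ∸ |K| ≤ length (edges R)
    M∸|K|≤|R| = capacity (M ∸ |K|) (+-cancelˡ-≤ (2 * |K|) _ _ (begin
      2 * |K| + 2 * (M ∸ |K|)    ≡⟨ *-distribˡ-+ 2 |K| (M ∸ |K|) ⟨
      2 * (|K| + (M ∸ |K|))      ≡⟨ cong (2 *_) (m+[n∸m]≡n |K|≤M) ⟩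
      2 * M                      ≤⟨ both-parts-suffice α k r n₂ c+n₂≡4+r 2k≤α[1+r] ⟩
      (2 + α) * (1 + α) + α * n₂ ≡⟨ cong (_+ α * n₂) 2|K|≡ ⟨
      2 * |K| + α * n₂           ∎))
    M≤|L| : M ≤ length (edges K ++ edges R)
    M≤|L| = begin
      M                               ≡⟨ m+[n∸m]≡n |K|≤M ⟨
      |K| + (M ∸ |K|)                 ≤⟨ +-monoʳ-≤ |K| M∸|K|≤|R| ⟩
      |K| + length (edges R)          ≡⟨ length-++ (edges K) ⟨
      length (edges K ++ edges R)     ∎

γ×-upper₂ : ∀ r α k → 2 * α + 3 ≤ 4 + r → α * r < 2 * k → 2 * k ≤ α * (1 + r) →
  ∃ λ D → IsKTupleDominating (4 + r) k D × length D ≡ k + 2 * α + 1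
γ×-upper₂ r α k 2α+3≤N αr<2k 2k≤α[1+r] =
  subst (λ N → ∃ λ D → IsKTupleDominating N k D × length D ≡ k + 2 * α + 1) c+n₂≡4+r
    (γ×-upper₂′ r α k n₂ c+n₂≡4+r α<n₂ (cancel-≤ 3 (2 * α) (1 + r) 2α+3≤N (solve (α ∷ [])) refl) αr<2k 2k≤α[1+r])
  where
  open ≤-Reasoning
  n₂ = (4 + r) ∸ (2 + α)
  c+n₂≡4+r : 2 + α + n₂ ≡ 4 + r
  c+n₂≡4+r = m+[n∸m]≡n (begin
    2 + α             ≤⟨ m≤m+n (2 + α) (α + 1) ⟩
    2 + α + (α + 1)   ≡⟨ solve (α ∷ []) ⟩
    2 * α + 3         ≤⟨ 2α+3≤N ⟩
    4 + r             ∎)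
  α<n₂ : α < n₂
  α<n₂ = +-cancelˡ-≤ (2 + α) (suc α) n₂ (begin
    2 + α + suc α  ≡⟨ solve (α ∷ []) ⟩
    2 * α + 3      ≤⟨ 2α+3≤N ⟩
    4 + r          ≡⟨ c+n₂≡4+r ⟨
    2 + α + n₂     ∎)

γ×≡-part₁ : ∀ A r k → 2 * suc A + 3 ≤ 4 + r → 2 * k + 4 * suc A ≤ suc A * (4 + r) → A * (4 + r) < 2 * k + 3 * A →
  γ×≡ (4 + r) k (k + 2 * suc A)
γ×≡-part₁ A r k N≥ 2k+4α≤αN A[4+r]<2k+3A =
  γ×-upper₁ (3 + r) (suc A) k α<N 2k+4α≤αN ,
  λ D isD → γ×-lower r k (2 * suc A) D isD (λ t s t<2α → ¬DegreeCase₁ A r k t s 2A+1≤r A[1+r]<2k (t≤2A+1 t<2α))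
  where
  open ≤-Reasoning
  α<N : suc A < 4 + r
  α<N = begin
    suc (suc A)           ≤⟨ m≤m+n (suc (suc A)) (A + 3) ⟩
    suc (suc A) + (A + 3) ≡⟨ solve (A ∷ []) ⟩
    2 * suc A + 3         ≤⟨ N≥ ⟩
    4 + r                 ∎
  2A+1≤r : 2 * A + 1 ≤ r
  2A+1≤r = cancel-≤ 4 (2 * A + 1) r N≥ (solve (A ∷ [])) refl
  A[1+r]<2k : A * (1 + r) < 2 * k
  A[1+r]<2k = +-cancelˡ-< (3 * A) _ _ (begin-strict
    3 * A + A * (1 + r) ≡⟨ solve (A ∷ r ∷ []) ⟩
    A * (4 + r)         <⟨ A[4+r]<2k+3A ⟩
    2 * k + 3 * A       ≡⟨ +-comm (2 * k) (3 * A) ⟩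
    3 * A + 2 * k       ∎)
  t≤2A+1 : ∀ {t} → t < 2 * suc A → t ≤ 2 * A + 1
  t≤2A+1 {t} t<2α = ≤-pred (≤-trans t<2α (≤-reflexive (solve (A ∷ []))))

⌈2k/α⌉-bounds : ∀ A k r → ⌈ 2 * k / suc A ⌉ ≡ 1 + r → suc A * r < 2 * k × 2 * k ≤ suc A * (1 + r)
⌈2k/α⌉-bounds A k r q≡1+r = below , above
  where
  open ≤-Reasoning
  α = suc A
  q = (2 * k + A) / α
  below : α * r < 2 * k
  below = +-cancelʳ-≤ A (suc (α * r)) (2 * k) (begin
    suc (suc A * r) + A ≡⟨ solve (A ∷ r ∷ []) ⟩
    (1 + r) * suc A     ≡⟨ cong (_* α) q≡1+r ⟨
    q * α               ≤⟨ m/n*n≤m (2 * k + A) α ⟩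
    2 * k + A           ∎)
  above : 2 * k ≤ α * (1 + r)
  above = +-cancelʳ-≤ A (2 * k) (α * (1 + r)) (begin
    2 * k + A                 ≡⟨ m≡m%n+[m/n]*n (2 * k + A) α ⟩
    (2 * k + A) % α + q * α   ≤⟨ +-monoˡ-≤ (q * α) (≤-pred (m%n<n (2 * k + A) α)) ⟩
    A + q * α                 ≡⟨ cong (λ z → A + z * α) q≡1+r ⟩
    A + (1 + r) * suc A       ≡⟨ solve (A ∷ r ∷ []) ⟩
    suc A * (1 + r) + A       ∎)

γ×≡-part₂ : ∀ A r k → 2 * suc A + 3 + suc A % 2 ≤ 4 + r → 4 + r ≡ ⌈ 2 * k / suc A ⌉ + 3 →
  γ×≡ (4 + r) k (k + 2 * suc A + 1)
γ×≡-part₂ A r k N≥ N≡⌈2k/α⌉+3 =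
  γ×-upper₂ r α k (≤-trans (m≤m+n _ (α % 2)) N≥) αr<2k 2k≤α[1+r] ,
  λ D isD → subst (_≤ length D) (sym (+-assoc k (2 * α) 1))
    (γ×-lower r k (2 * α + 1) D isD (λ t s t<2α+1 →
      ¬DegreeCase₂ α r k t s (s≤s z≤n) N≥ αr<2k (≤-pred (≤-trans t<2α+1 (≤-reflexive (+-comm (2 * α) 1))))))
  where
  α = suc A
  bounds : α * r < 2 * k × 2 * k ≤ α * (1 + r)
  bounds = ⌈2k/α⌉-bounds A k r (+-cancelʳ-≡ 3 _ (1 + r) (trans (sym N≡⌈2k/α⌉+3) (+-comm 3 (1 + r))))
  αr<2k : α * r < 2 * k
  αr<2k = proj₁ bounds
  2k≤α[1+r] : 2 * k ≤ α * (1 + r)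
  2k≤α[1+r] = proj₂ bounds

private
  4≤N : ∀ A x n → 2 * suc A + 3 + x ≤ n → 4 ≤ n
  4≤N A x n N≥ = begin
    4                    ≤⟨ m≤m+n 4 (2 * A + 1 + x) ⟩
    4 + (2 * A + 1 + x)  ≡⟨ solve (A ∷ x ∷ []) ⟩
    2 * suc A + 3 + x    ≤⟨ N≥ ⟩
    n                    ∎
    where open ≤-Reasoning

theorem28 : (α n k : ℕ) → 2 ≤ α → 2 * α + 3 + α % 2 ≤ n → 1 ≤ k →
  -- (1): (2/α) k + 4 ≤ n < (2/(α-1)) k + 3, cleared of denominators
  ((2 * k + 4 * α ≤ α * n → (α ∸ 1) * n < 2 * k + 3 * (α ∸ 1) →
      γ×≡ n k (k + 2 * α))
  -- (2): n = ⌈2k/α⌉ + 3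
  × (n ≡ ⌈ 2 * k / α ⌉ + 3 → γ×≡ n k (k + 2 * α + 1)))
-- only α ≥ 1 is used
theorem28 (suc A) n k _ N≥ _ with n ∸ 4 | m+[n∸m]≡n (4≤N A (suc A % 2) n N≥)
... | r | refl = γ×≡-part₁ A r k (≤-trans (m≤m+n _ (suc A % 2)) N≥) , γ×≡-part₂ A r k N≥
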